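{- Let $G$ be a connected graph on $n$ vertices whose block decomposition is nontrivial (i.e. $G$ has at least two blocks), and suppose that every block $B$ of $G$ has a spanning path (a path in $B$ containing all vertices of $B$) one of whose endpoints is a cut vertex of $G$. Then $G$ has a spanning tree $T$ in which the number of internal vertices is $n - |\mathrm{Bad}(G)|$.
   Context: All graphs are simple and undirected. A block of $G$ is a maximal connected subgraph of $G$ without cut vertices. A vertex of a tree is internal if its degree in the tree is at least $2$. For a block $B$ of $G$ and vertices $u,v\in V(B)$, a spanning path between $u$ and $v$ in $B$ is a path from $u$ to $v$ containing all vertices of $B$. A block $B$ is good if there exist distinct $u,v\in V(B)$, both cut vertices of $G$, such that $B$ has a spanning path between $u$ and $v$; otherwise $B$ is bad. $\mathrm{Bad}(G)$ denotes the set of bad blocks of $G$. -}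

module Defs where

open import Data.Nat using (ℕ; _≤_; _≤?_; _∸_)
open import Data.Fin using (Fin)
open import Data.Fin.Subset using (Subset; ⊤; _⊆_; ∣_∣) renaming (_∈_ to _∈ˢ_)
open import Data.Vec using (Vec; lookup)
open import Data.List using (List; []; _∷_; _++_; head; last; length; filter; allFin)
open import Data.List.Membership.Propositional using () renaming (_∈_ to _∈ˡ_)
open import Data.List.Relation.Unary.All using (All)
open import Data.List.Relation.Unary.Linked using (Linked)
open import Data.List.Relation.Unary.Unique.Propositional using (Unique)
open import Data.Maybe using (just)
open import Data.Product using (Σ; ∃; _×_)
open import Data.Sum using (_⊎_)
open import Relation.Nullary using (¬_)
open import Relation.Binary.PropositionalEquality using (_≡_; _≢_)

-- A (sub)graph is given by a vertex set and an edge set, the latter as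
-- an adjacency vector of subsets: j ∈ lookup es i  means  ij is an edge.
-- Concrete (Vec Bool) representation so that ≡ is extensional equality.

record Sub (n : ℕ) : Set where
  constructor sub
  field
    vs : Subset n
    es : Vec (Subset n) n
open Sub public

Edge : ∀ {n} → Sub n → Fin n → Fin n → Set
Edge H i j = j ∈ˢ lookup (es H) i

WellFormed : ∀ {n} → Sub n → Set
WellFormed H = (∀ i j → Edge H i j → (i ∈ˢ vs H) × (j ∈ˢ vs H))
             × (∀ i j → Edge H i j → Edge H j i)
             × (∀ i → ¬ Edge H i i)

_≤S_ : ∀ {n} → Sub n → Sub n → Set
H ≤S K = (vs H ⊆ vs K) × (∀ i j → Edge H i j → Edge K i j)

record Graph (n : ℕ) : Set where
  field
    adj   : Vec (Subset n) n
    sym   : ∀ i j → j ∈ˢ lookup adj i → i ∈ˢ lookup adj j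
    irrefl : ∀ i → ¬ (i ∈ˢ lookup adj i)
open Graph public

asSub : ∀ {n} → Graph n → Sub n
asSub G = sub ⊤ (adj G)

Reach : ∀ {n} → (Fin n → Fin n → Set) → Fin n → Fin n → Set
Reach R u w = Σ (List _) λ ps → Linked R ps × head ps ≡ just u × last ps ≡ just w

Connected : ∀ {n} → Sub n → Set
Connected H = (∃ λ v → v ∈ˢ vs H)
            × (∀ u w → u ∈ˢ vs H → w ∈ˢ vs H → Reach (Edge H) u w)

EdgeMinus : ∀ {n} → Sub n → Fin n → Fin n → Fin n → Set
EdgeMinus H v i j = Edge H i j × i ≢ v × j ≢ v

-- v is a cut vertex of H: deleting v increases the number of components,
-- i.e. two vertices of H - v connected in H become disconnected in H - v.
CutVertex : ∀ {n} → Sub n → Fin n → Set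
CutVertex H v = (v ∈ˢ vs H) × ∃ λ u → ∃ λ w →
    (u ∈ˢ vs H) × (w ∈ˢ vs H) × (u ≢ v) × (w ≢ v)
  × Reach (Edge H) u w × ¬ Reach (EdgeMinus H v) u w

NoCutVertex : ∀ {n} → Sub n → Set
NoCutVertex H = ∀ v → ¬ CutVertex H v

IsBlock : ∀ {n} → Graph n → Sub n → Set
IsBlock G B = WellFormed B × B ≤S asSub G × Connected B × NoCutVertex B
  × (∀ H → WellFormed H → H ≤S asSub G → B ≤S H → Connected H → NoCutVertex H → H ≤S B)

SpanningPath : ∀ {n} → Sub n → Fin n → Fin n → Set
SpanningPath B u v = Σ (List _) λ ps →
    Unique ps × Linked (Edge B) ps × head ps ≡ just u × last ps ≡ just v
  × All (λ x → x ∈ˢ vs B) ps × (∀ x → x ∈ˢ vs B → x ∈ˡ ps)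

Good : ∀ {n} → Graph n → Sub n → Set
Good G B = ∃ λ u → ∃ λ v → u ≢ v × CutVertex (asSub G) u × CutVertex (asSub G) v
         × SpanningPath B u v

Bad : ∀ {n} → Graph n → Sub n → Set
Bad G B = IsBlock G B × ¬ Good G B

-- L lists the set Bad(G) without repetition, so |Bad(G)| = length L
EnumeratesBad : ∀ {n} → Graph n → List (Sub n) → Set
EnumeratesBad G L = Unique L × (∀ B → B ∈ˡ L → Bad G B) × (∀ B → Bad G B → B ∈ˡ L)

Acyclic : ∀ {n} → Sub n → Set
Acyclic T = ∀ x y z (rest : List _) →
  Unique (x ∷ y ∷ z ∷ rest) → ¬ Linked (Edge T) (x ∷ y ∷ z ∷ rest ++ x ∷ [])

IsSpanningTree : ∀ {n} → Graph n → Sub n → Set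
IsSpanningTree G T = vs T ≡ ⊤ × WellFormed T × T ≤S asSub G × Connected T × Acyclic T

degree : ∀ {n} → Sub n → Fin n → ℕ
degree T i = ∣ lookup (es T) i ∣

internalCount : ∀ {n} → Sub n → ℕ
internalCount {n} T = length (filter (λ i → 2 ≤? degree T i) (allFin n))

{-# OPTIONS --safe #-}
-- Choose for every block a spanning path: between two cut vertices for a good block, and
-- with a cut vertex at one end for a bad one. The union T of these paths is a spanning tree:
-- the paths span the blocks and so connect G, and a cycle of T, being nonseparable, lies in a
-- single block, whose path is acyclic. A cut vertex has path neighbours in two blocks; any
-- other vertex lies in a unique block and is interior to its path unless it is the non-cut end
-- of the path of a bad block. These ends are the leaves of T, one for each bad block.

module Submission where

open import Defs renaming (sym to adj-sym)
open import Data.Bool using (true)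
open import Data.Empty using (⊥-elim)
open import Data.Fin using (Fin; zero; suc)
open import Data.Fin.Properties using (any?; all?) renaming (_≟_ to _≟F_)
open import Data.Fin.Subset using (Subset; ⊤; _⊆_; _⊂_; ∣_∣; _∪_; ⁅_⁆; inside; outside) renaming (_∈_ to _∈ˢ_)
open import Data.Fin.Subset.Properties using (_∈?_; _⊆?_; anySubset?; ∈⊤; ⊆-antisym; x∈p∪q⁻; x∈p∪q⁺; p⊆q⇒∣p∣≤∣q∣; p⊂q⇒∣p∣<∣q∣; ∣p∣≤n; x∈⁅y⁆⇒x≡y; x∈⁅x⁆; ∣⁅x⁆∣≡1; x≢y⇒x∉⁅y⁆)
open import Data.List using (List; []; _∷_; _++_; head; last; length; map; filter; allFin)
open import Data.List.Properties using (++-assoc; ++-identityʳ; length-map; length-tabulate)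
open import Data.List.Membership.Propositional using () renaming (_∈_ to _∈ˡ_)
open import Data.List.Membership.Propositional.Properties using (∈-++⁺ˡ; ∈-++⁺ʳ; ∈-++⁻; ∈-∃++; ∈-map⁺; ∈-map⁻; ∈-filter⁺; ∈-filter⁻; ∈-allFin)
import Data.List.Membership.DecPropositional as DecMembership
open import Data.List.Relation.Unary.All using (All; []; _∷_) renaming (all? to allˡ?; map to All-map; tabulate to All-tabulate)
open import Data.List.Relation.Unary.All.Properties using () renaming (++⁺ to All-++⁺)
open import Data.List.Relation.Unary.All.Properties.Core using (¬Any⇒All¬)
open import Data.List.Relation.Unary.Any using (here; there)
open import Data.List.Relation.Unary.AllPairs using ([]; _∷_)
open import Data.List.Relation.Unary.Linked as Linked using (Linked; []; [-]; _∷_)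
open import Data.List.Relation.Unary.Unique.Propositional using (Unique)
open import Data.List.Relation.Unary.Unique.Propositional.Properties using (filter⁺; allFin⁺)
import Data.List.Relation.Unary.Unique.DecPropositional as DecUnique
open import Data.Maybe using (Maybe; just; nothing; maybe)
open import Data.Maybe.Properties using (just-injective) renaming (≡-dec to ≡-decᴹ)
open import Data.Nat using (ℕ; zero; suc; _≤_; _<_; z≤n; s≤s; _+_; _*_; _∸_; _≤?_)
open import Data.Nat.Properties using (≤-trans; ≤-refl; <-trans; <-irrefl; suc-injective; n<1+n; +-suc; +-identityʳ; m≤n+m; +-mono-≤; +-mono-<-≤; +-mono-≤-<; <-≤-trans; <⇒≱; ≤⇒≯; m+n∸n≡m; ≤-antisym)
open import Data.Product using (Σ; ∃; ∃₂; _×_; _,_; proj₁; proj₂)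
open import Data.Sum using (_⊎_; inj₁; inj₂; [_,_])
open import Data.Unit using (tt) renaming (⊤ to Unit)
open import Data.Vec using (Vec; []; _∷_; lookup; tabulate; zipWith; _[_]=_)
open import Data.Vec.Properties using (lookup∘tabulate; tabulate∘lookup; tabulate-cong; lookup-zipWith; []=⇒lookup; lookup⇒[]=)
open import Relation.Binary using (Decidable)
open import Relation.Binary.Construct.Closure.ReflexiveTransitive using (Star; ε; _◅_; _◅◅_; _⋆) renaming (map to Star-map; reverse to Star-reverse)
open import Relation.Binary.PropositionalEquality using (_≡_; _≢_; refl; sym; trans; cong; cong₂; subst; module ≡-Reasoning)
open import Relation.Nullary using (¬_; Dec; yes; no; does)
open import Relation.Nullary.Decidable using (map′; _×-dec_; _⊎-dec_; _→-dec_; ¬?; decidable-stable; dec-true)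

Rel : ℕ → Set₁
Rel n = Fin n → Fin n → Set

-- Walks and decidability by finite search

module _ {n : ℕ} {R : Rel n} where

  vertices : ∀ {x y} → Star R x y → List (Fin n)
  vertices {x} ε = x ∷ []
  vertices {x} (e ◅ p) = x ∷ vertices p

  head-vertices : ∀ {x y} (p : Star R x y) → head (vertices p) ≡ just x
  head-vertices ε = refl
  head-vertices (e ◅ p) = refl

  last-vertices : ∀ {x y} (p : Star R x y) → last (vertices p) ≡ just y
  last-vertices ε = refl
  last-vertices (e ◅ ε) = refl
  last-vertices (e ◅ f ◅ p) = last-vertices (f ◅ p)

  linked-vertices : ∀ {x y} (p : Star R x y) → Linked R (vertices p)
  linked-vertices ε = [-]
  linked-vertices (e ◅ ε) = e ∷ [-]
  linked-vertices (e ◅ f ◅ p) = e ∷ linked-vertices (f ◅ p)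

  Star⇒Reach : ∀ {x y} → Star R x y → Reach R x y
  Star⇒Reach p = vertices p , linked-vertices p , head-vertices p , last-vertices p

  linked⇒Star : ∀ {x y} ps → Linked R ps → head ps ≡ just x → last ps ≡ just y → Star R x y
  linked⇒Star (a ∷ []) [-] refl refl = ε
  linked⇒Star (a ∷ b ∷ ps) (e ∷ lk) refl l = e ◅ linked⇒Star (b ∷ ps) lk refl l

  Reach⇒Star : ∀ {x y} → Reach R x y → Star R x y
  Reach⇒Star (ps , lk , h , l) = linked⇒Star ps lk h l

  SimplePath : Fin n → Fin n → List (Fin n) → Set
  SimplePath u w ps = Unique ps × Linked R ps × head ps ≡ just u × last ps ≡ just w

  linked-tail : ∀ {y ys} → Linked R (y ∷ ys) → Linked R ys
  linked-tail [-] = []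
  linked-tail (_ ∷ l) = l

  simplePath-suffix : ∀ {u w} qs → u ∈ˡ qs → Unique qs → Linked R qs → last qs ≡ just w
                    → ∃ (SimplePath u w)
  simplePath-suffix (u ∷ qs) (here refl) U lk l = u ∷ qs , U , lk , refl , l
  simplePath-suffix (y ∷ z ∷ qs) (there m) (_ ∷ U) lk l = simplePath-suffix (z ∷ qs) m U (linked-tail lk) l

  -- Cutting out the part between two visits of a vertex.
  Star⇒SimplePath : ∀ {u w} → Star R u w → ∃ (SimplePath u w)
  Star⇒SimplePath {u} ε = u ∷ [] , [] ∷ [] , [-] , refl , refl
  Star⇒SimplePath {u} (e ◅ p) with Star⇒SimplePath p
  ... | b ∷ qs , U , lk , refl , l with DecMembership._∈?_ _≟F_ u (b ∷ qs)
  ...   | yes m = simplePath-suffix (b ∷ qs) m U lk l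
  ...   | no ¬m = u ∷ b ∷ qs , ¬Any⇒All¬ (b ∷ qs) ¬m ∷ U , e ∷ lk , refl , l

module _ {A : Set} where

  All≢-∈ : ∀ {x : A} {xs a} → All (x ≢_) xs → a ∈ˡ xs → a ≢ x
  All≢-∈ (p ∷ _) (here refl) e = p (sym e)
  All≢-∈ (_ ∷ ps) (there m) e = All≢-∈ ps m e

  Unique-map⁺-on : ∀ {B : Set} (f : A → B) {xs} → Unique xs
                 → (∀ {a b} → a ∈ˡ xs → b ∈ˡ xs → f a ≡ f b → a ≡ b) → Unique (map f xs)
  Unique-map⁺-on f {[]} _ _ = []
  Unique-map⁺-on f {x ∷ xs} (x∉xs ∷ U) inj = map-∉ x∉xs (λ m → m) ∷ Unique-map⁺-on f U (λ a b → inj (there a) (there b))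
    where
      map-∉ : ∀ {ys} → All (x ≢_) ys → (∀ {y} → y ∈ˡ ys → y ∈ˡ xs) → All (f x ≢_) (map f ys)
      map-∉ [] _ = []
      map-∉ (x≢y ∷ x∉ys) ys⊆xs = (λ fx≡fy → x≢y (inj (here refl) (there (ys⊆xs (here refl))) fx≡fy))
                                ∷ map-∉ x∉ys (λ m → ys⊆xs (there m))

  length-filter-+-filter-¬ : ∀ {P : A → Set} (P? : ∀ x → Dec (P x)) xs
                           → length (filter P? xs) + length (filter (λ x → ¬? (P? x)) xs) ≡ length xs
  length-filter-+-filter-¬ P? [] = refl
  length-filter-+-filter-¬ P? (x ∷ xs) with P? x
  ... | yes _ = cong suc (length-filter-+-filter-¬ P? xs)
  ... | no _ = trans (+-suc (length (filter P? xs)) _) (cong suc (length-filter-+-filter-¬ P? xs))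

  remove : (∀ (x y : A) → Dec (x ≡ y)) → A → List A → List A
  remove _≟_ a [] = []
  remove _≟_ a (y ∷ ys) with a ≟ y
  ... | yes _ = ys
  ... | no _ = y ∷ remove _≟_ a ys

module _ {A : Set} (_≟_ : ∀ (x y : A) → Dec (x ≡ y)) where

  private
    length-remove : ∀ {a} ys → a ∈ˡ ys → suc (length (remove _≟_ a ys)) ≡ length ys
    length-remove {a} (y ∷ ys) m with a ≟ y
    ... | yes _ = refl
    length-remove (y ∷ ys) (here e) | no ne = ⊥-elim (ne e)
    length-remove (y ∷ ys) (there m) | no ne = cong suc (length-remove ys m)

    ∈-remove : ∀ {a b} ys → b ∈ˡ ys → b ≢ a → b ∈ˡ remove _≟_ a ys
    ∈-remove {a} (y ∷ ys) m ba with a ≟ y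
    ∈-remove (y ∷ ys) (here refl) ba | yes refl = ⊥-elim (ba refl)
    ∈-remove (y ∷ ys) (there m) ba | yes _ = m
    ∈-remove (y ∷ ys) (here e) ba | no _ = here e
    ∈-remove (y ∷ ys) (there m) ba | no _ = there (∈-remove ys m ba)

  unique-⊆⇒length≤ : ∀ xs ys → Unique xs → (∀ {a} → a ∈ˡ xs → a ∈ˡ ys) → length xs ≤ length ys
  unique-⊆⇒length≤ [] ys _ _ = z≤n
  unique-⊆⇒length≤ (x ∷ xs) ys (p ∷ U) xs⊆ys =
    subst (suc (length xs) ≤_) (length-remove ys (xs⊆ys (here refl)))
      (s≤s (unique-⊆⇒length≤ xs (remove _≟_ x ys) U
        (λ m → ∈-remove ys (xs⊆ys (there m)) (All≢-∈ p m))))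

module _ {n : ℕ} where

  unique⇒length≤n : (ps : List (Fin n)) → Unique ps → length ps ≤ n
  unique⇒length≤n ps U = subst (length ps ≤_) (length-tabulate (λ i → i))
    (unique-⊆⇒length≤ _≟F_ ps (allFin n) U (λ {a} _ → ∈-allFin a))

  any-list≤? : (k : ℕ) {P : List (Fin n) → Set} → (∀ ps → Dec (P ps)) → Dec (∃ λ ps → length ps ≤ k × P ps)
  any-list≤? zero P? with P? []
  ... | yes p = yes ([] , z≤n , p)
  ... | no ¬p = no λ { ([] , _ , p) → ¬p p }
  any-list≤? (suc k) P? with P? [] | any? (λ a → any-list≤? k (λ ps → P? (a ∷ ps)))
  ... | yes p | _ = yes ([] , z≤n , p)
  ... | no _ | yes (a , ps , le , p) = yes (a ∷ ps , s≤s le , p)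
  ... | no ¬p | no ¬q = no λ { ([] , _ , p) → ¬p p ; (a ∷ ps , s≤s le , p) → ¬q (a , ps , le , p) }

  -- Only simple paths need to be searched, and these are short.
  star? : {R : Rel n} → Decidable R → Decidable (Star R)
  star? R? u w with any-list≤? n (λ ps → DecUnique.unique? _≟F_ ps ×-dec (Linked.linked? R? ps
                                   ×-dec (≡-decᴹ _≟F_ (head ps) (just u) ×-dec ≡-decᴹ _≟F_ (last ps) (just w))))
  ... | yes (ps , _ , _ , lk , h , l) = yes (linked⇒Star ps lk h l)
  ... | no ¬p = no λ p → let (ps , U , rest) = Star⇒SimplePath p in ¬p (ps , unique⇒length≤n ps U , U , rest)

  reach? : {R : Rel n} → Decidable R → Decidable (Reach R)
  reach? R? u w = map′ Star⇒Reach Reach⇒Star (star? R? u w)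

any-vec? : {A : Set} → (∀ {P : A → Set} → (∀ a → Dec (P a)) → Dec (∃ P))
         → (m : ℕ) {P : Vec A m → Set} → (∀ v → Dec (P v)) → Dec (∃ P)
any-vec? any-A? zero P? with P? []
... | yes p = yes ([] , p)
... | no ¬p = no λ { ([] , p) → ¬p p }
any-vec? any-A? (suc m) P? with any-A? (λ a → any-vec? any-A? m (λ v → P? (a ∷ v)))
... | yes (a , v , p) = yes (a ∷ v , p)
... | no ¬p = no λ { (a ∷ v , p) → ¬p (a , v , p) }

module _ {n : ℕ} where

  any-sub? : {P : Sub n → Set} → (∀ H → Dec (P H)) → Dec (∃ P)
  any-sub? P? with anySubset? (λ vs → any-vec? anySubset? n (λ es → P? (sub vs es)))
  ... | yes (vs , es , p) = yes (sub vs es , p)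
  ... | no ¬p = no λ { (sub vs es , p) → ¬p (vs , es , p) }

  all-sub? : {P : Sub n → Set} → (∀ H → Dec (P H)) → Dec (∀ H → P H)
  all-sub? P? with any-sub? (λ H → ¬? (P? H))
  ... | yes (H , ¬p) = no λ f → ¬p (f H)
  ... | no ¬q = yes λ H → decidable-stable (P? H) λ ¬p → ¬q (H , ¬p)

  edge? : (H : Sub n) → Decidable (Edge H)
  edge? H i j = j ∈? lookup (es H) i

  edgeMinus? : (H : Sub n) (v : Fin n) → Decidable (EdgeMinus H v)
  edgeMinus? H v i j = edge? H i j ×-dec (¬? (i ≟F v) ×-dec ¬? (j ≟F v))

  wellFormed? : (H : Sub n) → Dec (WellFormed H)
  wellFormed? H = all? (λ i → all? (λ j → edge? H i j →-dec (i ∈? vs H ×-dec j ∈? vs H)))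
    ×-dec (all? (λ i → all? (λ j → edge? H i j →-dec edge? H j i))
    ×-dec all? (λ i → ¬? (edge? H i i)))

  _≤S?_ : (H K : Sub n) → Dec (H ≤S K)
  H ≤S? K = (vs H ⊆? vs K) ×-dec all? (λ i → all? (λ j → edge? H i j →-dec edge? K i j))

  connected? : (H : Sub n) → Dec (Connected H)
  connected? H = any? (λ v → v ∈? vs H) ×-dec
    all? (λ u → all? (λ w → (u ∈? vs H) →-dec ((w ∈? vs H) →-dec reach? (edge? H) u w)))

  cutVertex? : (H : Sub n) (v : Fin n) → Dec (CutVertex H v)
  cutVertex? H v = (v ∈? vs H) ×-dec any? (λ u → any? (λ w →
      (u ∈? vs H) ×-dec ((w ∈? vs H) ×-dec (¬? (u ≟F v) ×-dec (¬? (w ≟F v) ×-dec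
      (reach? (edge? H) u w ×-dec ¬? (reach? (edgeMinus? H v) u w)))))))

  noCutVertex? : (H : Sub n) → Dec (NoCutVertex H)
  noCutVertex? H = all? (λ v → ¬? (cutVertex? H v))

  isBlock? : (G : Graph n) (B : Sub n) → Dec (IsBlock G B)
  isBlock? G B = wellFormed? B ×-dec (B ≤S? asSub G ×-dec (connected? B ×-dec (noCutVertex? B ×-dec
    all-sub? (λ H → wellFormed? H →-dec (H ≤S? asSub G →-dec (B ≤S? H →-dec (connected? H →-dec
      (noCutVertex? H →-dec H ≤S? B))))))))

  spanningPath? : (B : Sub n) (u v : Fin n) → Dec (SpanningPath B u v)
  spanningPath? B u v with any-list≤? n (λ ps → DecUnique.unique? _≟F_ ps ×-dec (Linked.linked? (edge? B) ps ×-dec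
    (≡-decᴹ _≟F_ (head ps) (just u) ×-dec (≡-decᴹ _≟F_ (last ps) (just v) ×-dec
    (allˡ? (_∈? vs B) ps ×-dec all? (λ x → (x ∈? vs B) →-dec DecMembership._∈?_ _≟F_ x ps))))))
  ... | yes (ps , _ , p) = yes (ps , p)
  ... | no ¬p = no λ { (ps , p) → ¬p (ps , unique⇒length≤n ps (proj₁ p) , p) }

  good? : (G : Graph n) (B : Sub n) → Dec (Good G B)
  good? G B = any? (λ u → any? (λ v → ¬? (u ≟F v) ×-dec (cutVertex? (asSub G) u ×-dec
    (cutVertex? (asSub G) v ×-dec spanningPath? B u v))))

-- Paths given by their lists of vertices

module _ {n : ℕ} where

  data Consecutive : List (Fin n) → Fin n → Fin n → Set where
    here : ∀ {a b xs} → Consecutive (a ∷ b ∷ xs) a b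
    there : ∀ {y xs a b} → Consecutive xs a b → Consecutive (y ∷ xs) a b

  Adjacent : List (Fin n) → Fin n → Fin n → Set
  Adjacent ps a b = Consecutive ps a b ⊎ Consecutive ps b a

  Adjacent-sym : ∀ {ps a b} → Adjacent ps a b → Adjacent ps b a
  Adjacent-sym (inj₁ c) = inj₂ c
  Adjacent-sym (inj₂ c) = inj₁ c

  consecutive? : ∀ ps → Decidable (Consecutive ps)
  consecutive? [] a b = no λ ()
  consecutive? (x ∷ []) a b = no λ { (there ()) }
  consecutive? (x ∷ y ∷ xs) a b with x ≟F a | y ≟F b | consecutive? (y ∷ xs) a b
  ... | yes refl | yes refl | _ = yes here
  ... | _ | _ | yes c = yes (there c)
  ... | no x≢a | _ | no ¬c = no λ { here → x≢a refl ; (there c) → ¬c c }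
  ... | yes _ | no y≢b | no ¬c = no λ { here → y≢b refl ; (there c) → ¬c c }

  adjacent? : ∀ ps → Decidable (Adjacent ps)
  adjacent? ps a b = consecutive? ps a b ⊎-dec consecutive? ps b a

  Consecutive-∈ˡ : ∀ {ps a b} → Consecutive ps a b → a ∈ˡ ps
  Consecutive-∈ˡ here = here refl
  Consecutive-∈ˡ (there c) = there (Consecutive-∈ˡ c)

  Consecutive-∈ʳ : ∀ {ps a b} → Consecutive ps a b → b ∈ˡ ps
  Consecutive-∈ʳ here = there (here refl)
  Consecutive-∈ʳ (there c) = there (Consecutive-∈ʳ c)

  Adjacent-∈ˡ : ∀ {ps a b} → Adjacent ps a b → a ∈ˡ ps
  Adjacent-∈ˡ (inj₁ c) = Consecutive-∈ˡ c
  Adjacent-∈ˡ (inj₂ c) = Consecutive-∈ʳ c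

  Adjacent-∈ʳ : ∀ {ps a b} → Adjacent ps a b → b ∈ˡ ps
  Adjacent-∈ʳ (inj₁ c) = Consecutive-∈ʳ c
  Adjacent-∈ʳ (inj₂ c) = Consecutive-∈ˡ c

  linked-Consecutive : ∀ ps → Linked (Consecutive ps) ps
  linked-Consecutive [] = []
  linked-Consecutive (a ∷ []) = [-]
  linked-Consecutive (a ∷ b ∷ xs) = here ∷ Linked.map there (linked-Consecutive (b ∷ xs))

  linked-Adjacent : ∀ ps → Linked (Adjacent ps) ps
  linked-Adjacent ps = Linked.map inj₁ (linked-Consecutive ps)

  module _ {R : Rel n} where

    linked⇒R-Consecutive : ∀ {ps a b} → Linked R ps → Consecutive ps a b → R a b
    linked⇒R-Consecutive (r ∷ _) here = r
    linked⇒R-Consecutive (_ ∷ l) (there c) = linked⇒R-Consecutive l c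

    linked⇒R-Adjacent : (∀ {a b} → R a b → R b a) → ∀ {ps a b} → Linked R ps → Adjacent ps a b → R a b
    linked⇒R-Adjacent _ l (inj₁ c) = linked⇒R-Consecutive l c
    linked⇒R-Adjacent s l (inj₂ c) = s (linked⇒R-Consecutive l c)

    private
      linked⇒Star-from-head : ∀ {h xs a} → Linked R (h ∷ xs) → a ∈ˡ h ∷ xs → Star R h a
      linked⇒Star-from-head l (here refl) = ε
      linked⇒Star-from-head (r ∷ l) (there m) = r ◅ linked⇒Star-from-head l m

    linked⇒Star-between : (∀ {a b} → R a b → R b a) → ∀ {ps a b} → Linked R ps → a ∈ˡ ps → b ∈ˡ ps → Star R a b
    linked⇒Star-between s {_ ∷ _} l ma mb = Star-reverse s (linked⇒Star-from-head l ma) ◅◅ linked⇒Star-from-head l mb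

  position : Fin n → List (Fin n) → ℕ
  position a [] = zero
  position a (x ∷ xs) with a ≟F x
  ... | yes _ = zero
  ... | no _ = suc (position a xs)

  position-here : ∀ a xs → position a (a ∷ xs) ≡ zero
  position-here a xs with a ≟F a
  ... | yes _ = refl
  ... | no a≢a = ⊥-elim (a≢a refl)

  position-there : ∀ {a x} xs → a ≢ x → position a (x ∷ xs) ≡ suc (position a xs)
  position-there {a} {x} xs a≢x with a ≟F x
  ... | yes a≡x = ⊥-elim (a≢x a≡x)
  ... | no _ = refl

  position-Consecutive : ∀ {ps a b} → Unique ps → Consecutive ps a b → position b ps ≡ suc (position a ps)
  position-Consecutive {a ∷ b ∷ xs} {a} {b} ((a≢b ∷ _) ∷ _) here = begin
    position b (a ∷ b ∷ xs)     ≡⟨ position-there (b ∷ xs) (λ e → a≢b (sym e)) ⟩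
    suc (position b (b ∷ xs))   ≡⟨ cong suc (position-here b xs) ⟩
    suc zero                    ≡⟨ cong suc (position-here a (b ∷ xs)) ⟨
    suc (position a (a ∷ b ∷ xs)) ∎
    where open ≡-Reasoning
  position-Consecutive {y ∷ xs} {a} {b} (y∉xs ∷ U) (there c) = begin
    position b (y ∷ xs)       ≡⟨ position-there xs (All≢-∈ y∉xs (Consecutive-∈ʳ c)) ⟩
    suc (position b xs)       ≡⟨ cong suc (position-Consecutive U c) ⟩
    suc (suc (position a xs)) ≡⟨ cong suc (position-there xs (All≢-∈ y∉xs (Consecutive-∈ˡ c))) ⟨
    suc (position a (y ∷ xs)) ∎
    where open ≡-Reasoning

  position-injective : ∀ {ps a b} → a ∈ˡ ps → b ∈ˡ ps → position a ps ≡ position b ps → a ≡ b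
  position-injective {x ∷ xs} {a} {b} ma mb e with a ≟F x | b ≟F x
  ... | yes p | yes q = trans p (sym q)
  position-injective (here refl) mb e | no p | _ = ⊥-elim (p refl)
  position-injective ma (here refl) e | _ | no q = ⊥-elim (q refl)
  position-injective (there ma) (there mb) e | no p | no q = position-injective ma mb (suc-injective e)

  Consecutive-predecessor-unique : ∀ {ps a b d} → Unique ps → Consecutive ps a b → Consecutive ps d b → a ≡ d
  Consecutive-predecessor-unique U c c' = position-injective (Consecutive-∈ˡ c) (Consecutive-∈ˡ c')
    (suc-injective (trans (sym (position-Consecutive U c)) (position-Consecutive U c')))

  Consecutive-successor-unique : ∀ {ps a b d} → Unique ps → Consecutive ps a b → Consecutive ps a d → b ≡ d
  Consecutive-successor-unique U c c' = position-injective (Consecutive-∈ʳ c) (Consecutive-∈ʳ c')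
    (trans (position-Consecutive U c) (sym (position-Consecutive U c')))

  lastOr : Fin n → List (Fin n) → Fin n
  lastOr b [] = b
  lastOr b (c ∷ l) = lastOr c l

  lastOr-∷ʳ : ∀ b l x → lastOr b (l ++ x ∷ []) ≡ x
  lastOr-∷ʳ b [] x = refl
  lastOr-∷ʳ b (c ∷ l) x = lastOr-∷ʳ c l x

  NotHead : Fin n → List (Fin n) → Set
  NotHead a [] = Unit
  NotHead a (d ∷ _) = a ≢ d

  -- A walk of distinct vertices that starts with an F-step and whose every step is an F-step
  -- in one direction or the other keeps going forward: a backward step would return to the
  -- unique F-predecessor, which is the vertex just visited.
  module MonotoneWalk (F : Rel n) (μ : Fin n → ℕ) (_≺_ : ℕ → ℕ → Set)
           (≺-trans : ∀ {i j k} → i ≺ j → j ≺ k → i ≺ k)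
           (F-≺ : ∀ {a b} → F a b → μ a ≺ μ b)
           (F-predecessor-unique : ∀ {a b d} → F a b → F d b → a ≡ d)
           (Adj : Rel n) (Adj⇒F : ∀ {a b} → Adj a b → F a b ⊎ F b a) where

    measure-≺-last : ∀ {a b} l → F a b → Linked Adj (b ∷ l) → Unique (b ∷ l) → NotHead a l
                   → μ a ≺ μ (lastOr b l)
    measure-≺-last [] f _ _ _ = F-≺ f
    measure-≺-last {a} {b} (d ∷ l) f (r ∷ lk) ((_ ∷ b∉l) ∷ U) a≢d with Adj⇒F r
    ... | inj₁ fbd = ≺-trans (F-≺ f) (measure-≺-last l fbd lk U (notHead l b∉l))
      where notHead : ∀ l → All (b ≢_) l → NotHead b l
            notHead [] _ = tt
            notHead (_ ∷ _) (p ∷ _) = p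
    ... | inj₂ fdb = ⊥-elim (a≢d (F-predecessor-unique f fdb))

  Unique-rotate : ∀ {x : Fin n} xs → Unique (x ∷ xs) → Unique (xs ++ x ∷ [])
  Unique-rotate [] _ = [] ∷ []
  Unique-rotate {x} (y ∷ xs) ((x≢y ∷ x∉xs) ∷ (y∉xs ∷ U)) = y∉xs⁺ y∉xs ∷ Unique-rotate xs (x∉xs ∷ U)
    where
      y∉xs⁺ : ∀ {zs} → All (y ≢_) zs → All (y ≢_) (zs ++ x ∷ [])
      y∉xs⁺ [] = (λ e → x≢y (sym e)) ∷ []
      y∉xs⁺ (q ∷ qs) = q ∷ y∉xs⁺ qs

  -- The first step of a cycle goes forward or backward along ps; either way the position
  -- changes strictly monotonically all around the cycle, which is absurd.
  path-acyclic : ∀ {ps} → Unique ps → ∀ x y z rest → Unique (x ∷ y ∷ z ∷ rest)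
               → ¬ Linked (Adjacent ps) (x ∷ y ∷ z ∷ rest ++ x ∷ [])
  path-acyclic {ps} Ups x y z rest U@((_ ∷ x≢z ∷ _) ∷ _) (r ∷ lk) with r
  ... | inj₁ c = <-irrefl refl (subst (position x ps <_) (cong (λ v → position v ps) (lastOr-∷ʳ y (z ∷ rest) x))
          (Forward.measure-≺-last (z ∷ rest ++ x ∷ []) c lk (Unique-rotate (y ∷ z ∷ rest) U) x≢z))
    where
      module Forward = MonotoneWalk (Consecutive ps) (λ v → position v ps) _<_ <-trans
        (λ c → subst (_ <_) (sym (position-Consecutive Ups c)) (n<1+n _))
        (Consecutive-predecessor-unique Ups) (Adjacent ps) (λ a → a)
  ... | inj₂ c = <-irrefl refl (subst (_< position x ps) (cong (λ v → position v ps) (lastOr-∷ʳ y (z ∷ rest) x))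
          (Backward.measure-≺-last (z ∷ rest ++ x ∷ []) c lk (Unique-rotate (y ∷ z ∷ rest) U) x≢z))
    where
      module Backward = MonotoneWalk (λ a b → Consecutive ps b a) (λ v → position v ps) (λ i j → j < i)
        (λ p q → <-trans q p) (λ c → subst (_ <_) (sym (position-Consecutive Ups c)) (n<1+n _))
        (λ c c' → Consecutive-successor-unique Ups c c') (Adjacent ps) Adjacent-sym

  head-∈ : ∀ {ps} {v : Fin n} → head ps ≡ just v → v ∈ˡ ps
  head-∈ {x ∷ xs} refl = here refl

  last-∈ : ∀ {ps} {v : Fin n} → last ps ≡ just v → v ∈ˡ ps
  last-∈ {x ∷ []} refl = here refl
  last-∈ {x ∷ y ∷ xs} e = there (last-∈ {y ∷ xs} e)

  IsEnd : List (Fin n) → Fin n → Set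
  IsEnd ps v = head ps ≡ just v ⊎ last ps ≡ just v

  interior-or-end : ∀ {ps v} → v ∈ˡ ps → (∃₂ λ a b → Consecutive ps a v × Consecutive ps v b) ⊎ IsEnd ps v
  interior-or-end (here refl) = inj₂ (inj₁ refl)
  interior-or-end {a ∷ rest} {v} (there m) with interior-or-end {rest} m
  ... | inj₁ (p , q , c₁ , c₂) = inj₁ (p , q , there c₁ , there c₂)
  ... | inj₂ (inj₂ l) = inj₂ (inj₂ (last-∷ rest m l))
    where last-∷ : ∀ rest → v ∈ˡ rest → last rest ≡ just v → last (a ∷ rest) ≡ just v
          last-∷ (_ ∷ _) _ l = l
  interior-or-end {a ∷ v ∷ []} (there m) | inj₂ (inj₁ refl) = inj₂ (inj₂ refl)
  interior-or-end {a ∷ v ∷ c ∷ r} (there m) | inj₂ (inj₁ refl) = inj₁ (a , c , here , there here)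

  private
    last-has-predecessor : ∀ a b rest {v} → last (a ∷ b ∷ rest) ≡ just v → ∃ λ q → Consecutive (a ∷ b ∷ rest) q v
    last-has-predecessor a b [] refl = a , here
    last-has-predecessor a b (c ∷ r) l = let (q , cq) = last-has-predecessor b c r l in q , there cq

  has-Adjacent : ∀ {ps v x} → v ∈ˡ ps → x ∈ˡ ps → x ≢ v → ∃ (Adjacent ps v)
  has-Adjacent {ps} {v} {x} mv mx x≢v with interior-or-end mv
  ... | inj₁ (a , b , c₁ , c₂) = b , inj₁ c₂
  ... | inj₂ (inj₁ h) = from-head ps h mx
    where from-head : ∀ ps → head ps ≡ just v → x ∈ˡ ps → ∃ (Adjacent ps v)
          from-head (v ∷ []) refl (here refl) = ⊥-elim (x≢v refl)
          from-head (v ∷ c ∷ r) refl _ = c , inj₁ here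
  ... | inj₂ (inj₂ l) = from-last ps l mx
    where from-last : ∀ ps → last ps ≡ just v → x ∈ˡ ps → ∃ (Adjacent ps v)
          from-last (v ∷ []) refl (here refl) = ⊥-elim (x≢v refl)
          from-last (a ∷ b ∷ rest) l _ = let (q , c) = last-has-predecessor a b rest l in q , inj₂ c

  interior-neighbours-distinct : ∀ {ps a v b} → Unique ps → Consecutive ps a v → Consecutive ps v b → a ≢ b
  interior-neighbours-distinct {ps} {a} U c₁ c₂ refl = n≢2+n (position a ps)
    (trans (position-Consecutive U c₂) (cong suc (position-Consecutive U c₁)))
    where n≢2+n : ∀ m → m ≢ suc (suc m)
          n≢2+n zero ()
          n≢2+n (suc m) e = n≢2+n m (suc-injective e)

  head-no-predecessor : ∀ {ps q v} → Unique ps → head ps ≡ just v → ¬ Consecutive ps q v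
  head-no-predecessor {v ∷ b ∷ xs} ((v≢b ∷ _) ∷ _) refl here = v≢b refl
  head-no-predecessor {v ∷ xs} (v∉xs ∷ _) refl (there c) = All≢-∈ v∉xs (Consecutive-∈ʳ c) refl

  last-no-successor : ∀ {ps q v} → Unique ps → last ps ≡ just v → ¬ Consecutive ps v q
  last-no-successor {v ∷ b ∷ xs} (v∉xs ∷ _) l here = All≢-∈ v∉xs (last-∈ {b ∷ xs} l) refl
  last-no-successor {y ∷ b ∷ xs} (_ ∷ U) l (there c) = last-no-successor {b ∷ xs} U l c

  end-Adjacent-unique : ∀ {ps v q q'} → Unique ps → IsEnd ps v → Adjacent ps v q → Adjacent ps v q' → q ≡ q'
  end-Adjacent-unique U (inj₁ h) (inj₂ c) _ = ⊥-elim (head-no-predecessor U h c)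
  end-Adjacent-unique U (inj₁ h) _ (inj₂ c) = ⊥-elim (head-no-predecessor U h c)
  end-Adjacent-unique U (inj₁ h) (inj₁ c) (inj₁ c') = Consecutive-successor-unique U c c'
  end-Adjacent-unique U (inj₂ l) (inj₁ c) _ = ⊥-elim (last-no-successor U l c)
  end-Adjacent-unique U (inj₂ l) _ (inj₁ c) = ⊥-elim (last-no-successor U l c)
  end-Adjacent-unique U (inj₂ l) (inj₂ c) (inj₂ c') = Consecutive-predecessor-unique U c c'

  unique-head≡last⇒singleton : ∀ {ps u} → Unique ps → head ps ≡ just u → last ps ≡ just u → ps ≡ u ∷ []
  unique-head≡last⇒singleton {u ∷ []} U refl _ = refl
  unique-head≡last⇒singleton {u ∷ b ∷ xs} (u∉xs ∷ _) refl l = ⊥-elim (All≢-∈ u∉xs (last-∈ {b ∷ xs} l) refl)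

module _ {n : ℕ} {R : Rel n} where

  linked-++⁻ˡ : ∀ xs {ys} → Linked R (xs ++ ys) → Linked R xs
  linked-++⁻ˡ [] _ = []
  linked-++⁻ˡ (x ∷ []) _ = [-]
  linked-++⁻ˡ (x ∷ y ∷ xs) (r ∷ l) = r ∷ linked-++⁻ˡ (y ∷ xs) l

  linked-++⁻ʳ : ∀ xs {ys} → Linked R (xs ++ ys) → Linked R ys
  linked-++⁻ʳ [] l = l
  linked-++⁻ʳ (x ∷ xs) l = linked-++⁻ʳ xs (linked-tail l)

  linked-∷ʳ : ∀ xs {a b} → Linked R xs → last xs ≡ just a → R a b → Linked R (xs ++ b ∷ [])
  linked-∷ʳ (x ∷ []) [-] refl r = r ∷ [-]
  linked-∷ʳ (x ∷ y ∷ xs) (r' ∷ l) e r = r' ∷ linked-∷ʳ (y ∷ xs) l e r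

  linked-glue : ∀ ys {x zs} → Linked R (ys ++ x ∷ []) → Linked R (x ∷ zs) → Linked R (ys ++ x ∷ zs)
  linked-glue [] _ l = l
  linked-glue (y ∷ []) (r ∷ _) l = r ∷ l
  linked-glue (y ∷ y' ∷ ys) (r ∷ l₁) l = r ∷ linked-glue (y' ∷ ys) l₁ l

  -- Going once round the closed walk as ++ v ∷ bs ++ [x], starting after v.
  linked-rotate : ∀ {x v} as bs → head (as ++ v ∷ []) ≡ just x → Linked R (as ++ v ∷ bs ++ x ∷ [])
                → Linked R (bs ++ as)
  linked-rotate [] bs refl l = subst (Linked R) (sym (++-identityʳ bs)) (linked-++⁻ˡ bs (linked-tail l))
  linked-rotate (a ∷ as) bs refl l = linked-glue bs (linked-tail (linked-++⁻ʳ (a ∷ as) l)) (linked-++⁻ˡ (a ∷ as) l)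

  linked-All : ∀ {P : Fin n → Set} {xs} → Linked R xs → All P xs → Linked (λ a b → R a b × P a × P b) xs
  linked-All [] _ = []
  linked-All [-] _ = [-]
  linked-All (r ∷ l) (p ∷ ps@(q ∷ _)) = (r , p , q) ∷ linked-All l ps

-- Subgraphs and blocks

NonSeparable : ∀ {n} → Sub n → Set
NonSeparable H = WellFormed H × Connected H × NoCutVertex H

module _ {n : ℕ} where

  nonSeparable? : (H : Sub n) → Dec (NonSeparable H)
  nonSeparable? H = wellFormed? H ×-dec (connected? H ×-dec noCutVertex? H)

  edge-sym : (H : Sub n) → WellFormed H → ∀ {i j} → Edge H i j → Edge H j i
  edge-sym H (_ , s , _) = s _ _

  edge-endpoints : (H : Sub n) → WellFormed H → ∀ {i j} → Edge H i j → (i ∈ˢ vs H) × (j ∈ˢ vs H)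
  edge-endpoints H (e , _ , _) = e _ _

  edge-irrefl : (H : Sub n) → WellFormed H → ∀ {i j} → Edge H i j → i ≢ j
  edge-irrefl H (_ , _ , irr) {i} e refl = irr i e

  connected⇒Star : (H : Sub n) → Connected H → ∀ {u w} → u ∈ˢ vs H → w ∈ˢ vs H → Star (Edge H) u w
  connected⇒Star H (_ , c) {u} {w} uH wH = Reach⇒Star (c u w uH wH)

  -- If v ∉ H there is nothing to avoid; otherwise v is not a cut vertex.
  nonSeparable⇒avoiding-Star : (H : Sub n) → NonSeparable H → ∀ {v x y} → x ∈ˢ vs H → y ∈ˢ vs H
                             → x ≢ v → y ≢ v → Star (EdgeMinus H v) x y
  nonSeparable⇒avoiding-Star H (wf , cn , nc) {v} {x} {y} xH yH xv yv with star? (edgeMinus? H v) x y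
  ... | yes p = p
  ... | no ¬p with v ∈? vs H
  ...   | yes vH = ⊥-elim (nc v (vH , x , y , xH , yH , xv , yv , proj₂ cn x y xH yH , λ r → ¬p (Reach⇒Star r)))
  ...   | no v∉H = Star-map avoid (connected⇒Star H cn xH yH)
    where
      avoid : ∀ {i j} → Edge H i j → EdgeMinus H v i j
      avoid e = e , (λ { refl → v∉H (proj₁ (edge-endpoints H wf e)) })
                  , (λ { refl → v∉H (proj₂ (edge-endpoints H wf e)) })

  ≤S-refl : (H : Sub n) → H ≤S H
  ≤S-refl H = (λ x → x) , (λ i j e → e)

  ≤S-trans : (H K M : Sub n) → H ≤S K → K ≤S M → H ≤S M
  ≤S-trans H K M (a , b) (c , d) = (λ x → c (a x)) , λ i j e → d i j (b i j e)

  ≤S-antisym : (H K : Sub n) → H ≤S K → K ≤S H → H ≡ K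
  ≤S-antisym (sub v₁ e₁) (sub v₂ e₂) (a , b) (c , d) = cong₂ sub (⊆-antisym a c) (begin
      e₁                ≡⟨ tabulate∘lookup e₁ ⟨
      tabulate (lookup e₁) ≡⟨ tabulate-cong (λ i → ⊆-antisym (b i _) (d i _)) ⟩
      tabulate (lookup e₂) ≡⟨ tabulate∘lookup e₂ ⟩
      e₂                ∎)
    where open ≡-Reasoning

  EdgeMinus-mono : (H K : Sub n) → H ≤S K → ∀ {v i j} → EdgeMinus H v i j → EdgeMinus K v i j
  EdgeMinus-mono H K (_ , f) (e , a , b) = f _ _ e , a , b

  _∪S_ : Sub n → Sub n → Sub n
  H ∪S K = sub (vs H ∪ vs K) (zipWith _∪_ (es H) (es K))

  module _ (H K : Sub n) where

    ∪S-vs⁻ : ∀ {i} → i ∈ˢ vs (H ∪S K) → i ∈ˢ vs H ⊎ i ∈ˢ vs K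
    ∪S-vs⁻ = x∈p∪q⁻ (vs H) (vs K)

    ∪S-edge⁻ : ∀ {i j} → Edge (H ∪S K) i j → Edge H i j ⊎ Edge K i j
    ∪S-edge⁻ {i} e = x∈p∪q⁻ (lookup (es H) i) (lookup (es K) i) (subst (_ ∈ˢ_) (lookup-zipWith _∪_ i (es H) (es K)) e)

    ∪S-edge⁺ : ∀ {i j} → Edge H i j ⊎ Edge K i j → Edge (H ∪S K) i j
    ∪S-edge⁺ {i} e = subst (_ ∈ˢ_) (sym (lookup-zipWith _∪_ i (es H) (es K))) (x∈p∪q⁺ e)

    ≤S-∪Sˡ : H ≤S (H ∪S K)
    ≤S-∪Sˡ = (λ x → x∈p∪q⁺ (inj₁ x)) , λ i j e → ∪S-edge⁺ (inj₁ e)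

    ≤S-∪Sʳ : K ≤S (H ∪S K)
    ≤S-∪Sʳ = (λ x → x∈p∪q⁺ (inj₂ x)) , λ i j e → ∪S-edge⁺ (inj₂ e)

    ∪S-least : (M : Sub n) → H ≤S M → K ≤S M → (H ∪S K) ≤S M
    ∪S-least M (hv , he) (kv , ke) = (λ x → [ hv , kv ] (∪S-vs⁻ x)) , λ i j e → [ he i j , ke i j ] (∪S-edge⁻ e)

    ∪S-wellFormed : WellFormed H → WellFormed K → WellFormed (H ∪S K)
    ∪S-wellFormed wH wK =
      (λ i j e → [ (λ e → both (proj₁ ≤S-∪Sˡ) (edge-endpoints H wH e)) , (λ e → both (proj₁ ≤S-∪Sʳ) (edge-endpoints K wK e)) ] (∪S-edge⁻ e)) ,
      (λ i j e → ∪S-edge⁺ ([ (λ e → inj₁ (edge-sym H wH e)) , (λ e → inj₂ (edge-sym K wK e)) ] (∪S-edge⁻ e))) ,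
      (λ i e → [ (λ e → edge-irrefl H wH e refl) , (λ e → edge-irrefl K wK e refl) ] (∪S-edge⁻ e))
      where
        both : ∀ {p q : Subset n} {i j} → p ⊆ q → (i ∈ˢ p) × (j ∈ˢ p) → (i ∈ˢ q) × (j ∈ˢ q)
        both p⊆q (a , b) = p⊆q a , p⊆q b

    -- Every vertex of H ∪S K reaches one of the common vertices a, b other than v inside H or K.
    ∪S-nonSeparable : ∀ {a b} → NonSeparable H → NonSeparable K → a ≢ b
                    → a ∈ˢ vs H → b ∈ˢ vs H → a ∈ˢ vs K → b ∈ˢ vs K → NonSeparable (H ∪S K)
    ∪S-nonSeparable {a} {b} nH@(wH , cH , _) nK@(wK , cK , _) a≢b aH bH aK bK =
      wU , ((a , x∈p∪q⁺ (inj₁ aH)) , connected) , noCut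
      where
        wU = ∪S-wellFormed wH wK
        toCommon : ∀ {u v s} → u ∈ˢ vs (H ∪S K) → u ≢ v → s ≢ v → s ∈ˢ vs H → s ∈ˢ vs K
                 → Star (EdgeMinus (H ∪S K) v) u s
        toCommon {u} uU uv sv sH sK with ∪S-vs⁻ uU
        ... | inj₁ uH = Star-map (EdgeMinus-mono H (H ∪S K) ≤S-∪Sˡ) (nonSeparable⇒avoiding-Star H nH uH sH uv sv)
        ... | inj₂ uK = Star-map (EdgeMinus-mono K (H ∪S K) ≤S-∪Sʳ) (nonSeparable⇒avoiding-Star K nK uK sK uv sv)
        symMinus : ∀ {v i j} → EdgeMinus (H ∪S K) v i j → EdgeMinus (H ∪S K) v j i
        symMinus (e , p , q) = edge-sym (H ∪S K) wU e , q , p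
        toA : ∀ {u} → u ∈ˢ vs (H ∪S K) → Star (Edge (H ∪S K)) u a
        toA uU with ∪S-vs⁻ uU
        ... | inj₁ uH = Star-map (proj₂ ≤S-∪Sˡ _ _) (connected⇒Star H cH uH aH)
        ... | inj₂ uK = Star-map (proj₂ ≤S-∪Sʳ _ _) (connected⇒Star K cK uK aK)
        connected : ∀ u w → u ∈ˢ vs (H ∪S K) → w ∈ˢ vs (H ∪S K) → Reach (Edge (H ∪S K)) u w
        connected u w uU wU' = Star⇒Reach (toA uU ◅◅ Star-reverse (edge-sym (H ∪S K) wU) (toA wU'))
        noCut : NoCutVertex (H ∪S K)
        noCut v (_ , u , w , uU , wU' , uv , wv , _ , ¬r) with a ≟F v
        ... | no av = ¬r (Star⇒Reach (toCommon uU uv av aH aK ◅◅ Star-reverse symMinus (toCommon wU' wv av aH aK)))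
        ... | yes refl = ¬r (Star⇒Reach (toCommon uU uv bv bH bK ◅◅ Star-reverse symMinus (toCommon wU' wv bv bH bK)))
          where bv : b ≢ a
                bv = λ e → a≢b (sym e)

  module _ (G : Graph n) where

    block-nonSeparable : ∀ {B} → IsBlock G B → NonSeparable B
    block-nonSeparable (w , _ , c , nc , _) = w , c , nc

    block-maximal : ∀ {B H} → IsBlock G B → NonSeparable H → H ≤S asSub G → B ≤S H → H ≤S B
    block-maximal {H = H} (_ , _ , _ , _ , max) (w , c , nc) hG bH = max H w hG bH c nc

    nonSeparable-≤S-block : ∀ {C B a b} → NonSeparable C → C ≤S asSub G → IsBlock G B → a ≢ b
                          → a ∈ˢ vs C → b ∈ˢ vs C → a ∈ˢ vs B → b ∈ˢ vs B → C ≤S B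
    nonSeparable-≤S-block {C} {B} nC cG isB a≢b aC bC aB bB =
      ≤S-trans C (C ∪S B) B (≤S-∪Sˡ C B)
        (block-maximal {B} {C ∪S B} isB (∪S-nonSeparable C B nC (block-nonSeparable {B} isB) a≢b aC bC aB bB)
          (∪S-least C B (asSub G) cG (proj₁ (proj₂ isB))) (≤S-∪Sʳ C B))

    blocks-sharing-two-vertices-equal : ∀ {B₁ B₂ a b} → IsBlock G B₁ → IsBlock G B₂ → a ≢ b
      → a ∈ˢ vs B₁ → b ∈ˢ vs B₁ → a ∈ˢ vs B₂ → b ∈ˢ vs B₂ → B₁ ≡ B₂
    blocks-sharing-two-vertices-equal {B₁} {B₂} b₁ b₂ a≢b a₁ b₁' a₂ b₂' =
      ≤S-antisym B₁ B₂
        (nonSeparable-≤S-block {B₁} {B₂} (block-nonSeparable {B₁} b₁) (proj₁ (proj₂ b₁)) b₂ a≢b a₁ b₁' a₂ b₂')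
        (nonSeparable-≤S-block {B₂} {B₁} (block-nonSeparable {B₂} b₂) (proj₁ (proj₂ b₂)) b₁ a≢b a₂ b₂' a₁ b₁')

module _ {n : ℕ} where

  private
    does-true : ∀ {P : Set} (P? : Dec P) → does P? ≡ true → P
    does-true (yes p) _ = p

  toSubset : {P : Fin n → Set} → (∀ i → Dec (P i)) → Subset n
  toSubset P? = tabulate (λ i → does (P? i))

  ∈-toSubset⁺ : {P : Fin n → Set} (P? : ∀ i → Dec (P i)) → ∀ {i} → P i → i ∈ˢ toSubset P?
  ∈-toSubset⁺ P? {i} p = lookup⇒[]= i _ (trans (lookup∘tabulate (λ i → does (P? i)) i) (dec-true (P? i) p))

  ∈-toSubset⁻ : {P : Fin n → Set} (P? : ∀ i → Dec (P i)) → ∀ {i} → i ∈ˢ toSubset P? → P i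
  ∈-toSubset⁻ P? {i} m = does-true (P? i) (trans (sym (lookup∘tabulate (λ i → does (P? i)) i)) ([]=⇒lookup m))

  toSub : {V : Fin n → Set} {E : Rel n} → (∀ k → Dec (V k)) → Decidable E → Sub n
  toSub V? E? = sub (toSubset V?) (tabulate (λ k → toSubset (E? k)))

  module _ {V : Fin n → Set} {E : Rel n} (V? : ∀ k → Dec (V k)) (E? : Decidable E) where

    toSub-vs⁺ : ∀ {k} → V k → k ∈ˢ vs (toSub V? E?)
    toSub-vs⁺ = ∈-toSubset⁺ V?

    toSub-vs⁻ : ∀ {k} → k ∈ˢ vs (toSub V? E?) → V k
    toSub-vs⁻ = ∈-toSubset⁻ V?

    toSub-edge⁺ : ∀ {k l} → E k l → Edge (toSub V? E?) k l
    toSub-edge⁺ {k} e = subst (_ ∈ˢ_) (sym (lookup∘tabulate (λ k → toSubset (E? k)) k)) (∈-toSubset⁺ (E? k) e)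

    toSub-edge⁻ : ∀ {k l} → Edge (toSub V? E?) k l → E k l
    toSub-edge⁻ {k} e = ∈-toSubset⁻ (E? k) (subst (_ ∈ˢ_) (lookup∘tabulate (λ k → toSubset (E? k)) k) e)

module _ {n : ℕ} (i j : Fin n) where

  private
    Endpoint : Fin n → Set
    Endpoint k = k ≡ i ⊎ k ≡ j

    Joins : Rel n
    Joins k l = (k ≡ i × l ≡ j) ⊎ (k ≡ j × l ≡ i)

    endpoint? : ∀ k → Dec (Endpoint k)
    endpoint? k = (k ≟F i) ⊎-dec (k ≟F j)

    joins? : Decidable Joins
    joins? k l = ((k ≟F i) ×-dec (l ≟F j)) ⊎-dec ((k ≟F j) ×-dec (l ≟F i))

  K₂ : Sub n
  K₂ = toSub endpoint? joins?

  K₂-vs⁺ : ∀ {k} → k ≡ i ⊎ k ≡ j → k ∈ˢ vs K₂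
  K₂-vs⁺ = toSub-vs⁺ endpoint? joins?

  private
    K₂-vs⁻ = toSub-vs⁻ endpoint? joins?
    K₂-edge⁻ = toSub-edge⁻ endpoint? joins?
    K₂-edge⁺ = toSub-edge⁺ endpoint? joins?

  K₂-edge : Edge K₂ i j
  K₂-edge = K₂-edge⁺ (inj₁ (refl , refl))

  K₂-≤S : (G : Graph n) → Edge (asSub G) i j → K₂ ≤S asSub G
  K₂-≤S G ij = (λ _ → ∈⊤) , λ k l e → edge (K₂-edge⁻ e)
    where
      edge : ∀ {k l} → Joins k l → Edge (asSub G) k l
      edge (inj₁ (refl , refl)) = ij
      edge (inj₂ (refl , refl)) = adj-sym G i j ij

  K₂-nonSeparable : i ≢ j → NonSeparable K₂
  K₂-nonSeparable i≢j = wf , ((i , K₂-vs⁺ (inj₁ refl)) , connected) , noCut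
    where
      wf : WellFormed K₂
      wf = (λ k l e → endpoints (K₂-edge⁻ e)) , (λ k l e → K₂-edge⁺ (swap (K₂-edge⁻ e))) , λ k e → loop (K₂-edge⁻ e)
        where
          endpoints : ∀ {k l} → Joins k l → (k ∈ˢ vs K₂) × (l ∈ˢ vs K₂)
          endpoints (inj₁ (a , b)) = K₂-vs⁺ (inj₁ a) , K₂-vs⁺ (inj₂ b)
          endpoints (inj₂ (a , b)) = K₂-vs⁺ (inj₂ a) , K₂-vs⁺ (inj₁ b)
          swap : ∀ {k l} → Joins k l → Joins l k
          swap (inj₁ (a , b)) = inj₂ (b , a)
          swap (inj₂ (a , b)) = inj₁ (b , a)
          loop : ∀ {k} → ¬ Joins k k
          loop (inj₁ (refl , b)) = i≢j b
          loop (inj₂ (refl , b)) = i≢j (sym b)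
      toI : ∀ {k} → k ∈ˢ vs K₂ → Star (Edge K₂) k i
      toI m with K₂-vs⁻ m
      ... | inj₁ refl = ε
      ... | inj₂ refl = K₂-edge⁺ (inj₂ (refl , refl)) ◅ ε
      connected : ∀ u w → u ∈ˢ vs K₂ → w ∈ˢ vs K₂ → Reach (Edge K₂) u w
      connected u w um wm = Star⇒Reach (toI um ◅◅ Star-reverse (edge-sym K₂ wf) (toI wm))
      -- Removing one of two vertices leaves a single vertex.
      noCut : NoCutVertex K₂
      noCut v (vm , u , w , um , wm , u≢v , w≢v , _ , ¬r) =
        ¬r (Star⇒Reach (subst (Star (EdgeMinus K₂ v) u) (same (K₂-vs⁻ vm) (K₂-vs⁻ um) (K₂-vs⁻ wm) u≢v w≢v) ε))
        where
          same : ∀ {v u w} → Endpoint v → Endpoint u → Endpoint w → u ≢ v → w ≢ v → u ≡ w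
          same _ (inj₁ refl) (inj₁ refl) _ _ = refl
          same _ (inj₂ refl) (inj₂ refl) _ _ = refl
          same (inj₁ refl) (inj₁ refl) _ u≢v _ = ⊥-elim (u≢v refl)
          same (inj₂ refl) (inj₁ refl) (inj₂ refl) _ w≢v = ⊥-elim (w≢v refl)
          same (inj₁ refl) (inj₂ refl) (inj₁ refl) _ w≢v = ⊥-elim (w≢v refl)
          same (inj₂ refl) (inj₂ refl) _ u≢v _ = ⊥-elim (u≢v refl)

module _ {n : ℕ} where

  private
    sizes : ∀ {m} → Vec (Subset n) m → ℕ
    sizes [] = 0
    sizes (x ∷ xs) = ∣ x ∣ + sizes xs

    sizes-mono : ∀ {m} (xs ys : Vec (Subset n) m) → (∀ i → lookup xs i ⊆ lookup ys i) → sizes xs ≤ sizes ys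
    sizes-mono [] [] f = z≤n
    sizes-mono (x ∷ xs) (y ∷ ys) f = +-mono-≤ (p⊆q⇒∣p∣≤∣q∣ (f zero)) (sizes-mono xs ys (λ i → f (suc i)))

    sizes-strict : ∀ {m} (xs ys : Vec (Subset n) m) → (∀ i → lookup xs i ⊆ lookup ys i) → ∀ i
                 → lookup xs i ⊂ lookup ys i → sizes xs < sizes ys
    sizes-strict (x ∷ xs) (y ∷ ys) f zero s = +-mono-<-≤ (p⊂q⇒∣p∣<∣q∣ s) (sizes-mono xs ys (λ i → f (suc i)))
    sizes-strict (x ∷ xs) (y ∷ ys) f (suc i) s = +-mono-≤-< (p⊆q⇒∣p∣≤∣q∣ (f zero)) (sizes-strict xs ys (λ i → f (suc i)) i s)

    sizes-bound : ∀ {m} (xs : Vec (Subset n) m) → sizes xs ≤ m * n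
    sizes-bound [] = z≤n
    sizes-bound (x ∷ xs) = +-mono-≤ (∣p∣≤n x) (sizes-bound xs)

    ⊆-⊉⇒⊂ : ∀ (p q : Subset n) → p ⊆ q → ¬ q ⊆ p → p ⊂ q
    ⊆-⊉⇒⊂ p q p⊆q q⊈p with any? (λ x → (x ∈? q) ×-dec ¬? (x ∈? p))
    ... | yes (x , x∈q , x∉p) = p⊆q , x , x∈q , x∉p
    ... | no ¬w = ⊥-elim (q⊈p λ {x} x∈q → decidable-stable (x ∈? p) λ x∉p → ¬w (x , x∈q , x∉p))

  size : Sub n → ℕ
  size H = ∣ vs H ∣ + sizes (es H)

  size≤n+n² : ∀ H → size H ≤ n + n * n
  size≤n+n² H = +-mono-≤ (∣p∣≤n (vs H)) (sizes-bound (es H))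

  size-strict : ∀ (H K : Sub n) → H ≤S K → ¬ K ≤S H → size H < size K
  size-strict H K (a , b) K≰H with vs K ⊆? vs H
  ... | no nv = +-mono-<-≤ (p⊂q⇒∣p∣<∣q∣ (⊆-⊉⇒⊂ (vs H) (vs K) a nv)) (sizes-mono (es H) (es K) λ i → b i _)
  ... | yes kv with any? (λ i → ¬? (lookup (es K) i ⊆? lookup (es H) i))
  ...   | yes (i , ni) = +-mono-≤-< (p⊆q⇒∣p∣≤∣q∣ a)
            (sizes-strict (es H) (es K) (λ i → b i _) i (⊆-⊉⇒⊂ _ _ (b i _) ni))
  ...   | no ¬i = ⊥-elim (K≰H (kv , λ i j e → decidable-stable (lookup (es K) i ⊆? lookup (es H) i) (λ z → ¬i (i , z)) e))

  module _ (G : Graph n) where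

    -- Enlarge while possible: the size grows strictly and is bounded by n + n * n.
    extend-to-block : (fuel : ℕ) (H : Sub n) → NonSeparable H → H ≤S asSub G → n + n * n ≤ size H + fuel
                    → ∃ λ B → IsBlock G B × H ≤S B
    extend-to-block fuel H nH@(wH , cH , ncH) hG bound
      with any-sub? (λ K → nonSeparable? K ×-dec (K ≤S? asSub G ×-dec (H ≤S? K ×-dec ¬? (K ≤S? H))))
    ... | no ¬larger = H , (wH , hG , cH , ncH , maximal) , ≤S-refl H
      where
        maximal : ∀ K → WellFormed K → K ≤S asSub G → H ≤S K → Connected K → NoCutVertex K → K ≤S H
        maximal K w kG hK c nc = decidable-stable (K ≤S? H) (λ K≰H → ¬larger (K , (w , c , nc) , kG , hK , K≰H))
    ... | yes (K , nK , kG , hK , K≰H) with fuel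
    ...   | zero = ⊥-elim (<⇒≱ (<-≤-trans (size-strict H K hK K≰H) (size≤n+n² K))
                   (subst (n + n * n ≤_) (+-identityʳ (size H)) bound))
    ...   | suc fuel' = let (B , isB , K≤B) = extend-to-block fuel' K nK kG bound' in B , isB , ≤S-trans H K B hK K≤B
      where
        bound' : n + n * n ≤ size K + fuel'
        bound' = ≤-trans bound (subst (_≤ size K + fuel') (sym (+-suc (size H) fuel'))
                   (+-mono-≤ (size-strict H K hK K≰H) ≤-refl))

    nonSeparable⇒≤S-block : ∀ {H} → NonSeparable H → H ≤S asSub G → ∃ λ B → IsBlock G B × H ≤S B
    nonSeparable⇒≤S-block {H} nH hG = extend-to-block (n + n * n) H nH hG (m≤n+m _ (size H))

    edge-in-block : ∀ {i j} → Edge (asSub G) i j → ∃ λ B → IsBlock G B × Edge B i j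
    edge-in-block {i} {j} ij =
      let (B , isB , K₂≤B) = nonSeparable⇒≤S-block {K₂ i j} (K₂-nonSeparable i j (λ { refl → irrefl G i ij })) (K₂-≤S i j G ij)
      in B , isB , proj₂ K₂≤B i j (K₂-edge i j)

    -- A block {s} would be properly contained in the nonseparable edge graph at s.
    block-not-singleton : ∀ {B s k} → IsBlock G B → Edge (asSub G) s k → ¬ (∀ {x} → x ∈ˢ vs B → x ≡ s)
    block-not-singleton {B} {s} {k} isB sk only-s = irrefl G s (subst (Edge (asSub G) s) k≡s sk)
      where
        s≢k : s ≢ k
        s≢k refl = irrefl G s sk
        B≤K₂ : B ≤S K₂ s k
        B≤K₂ = (λ m → K₂-vs⁺ s k (inj₁ (only-s m))) ,
               λ a b e → ⊥-elim (edge-irrefl B (proj₁ isB) e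
                 (trans (only-s (proj₁ (edge-endpoints B (proj₁ isB) e))) (sym (only-s (proj₂ (edge-endpoints B (proj₁ isB) e))))))
        k≡s : k ≡ s
        k≡s = only-s (proj₁ (block-maximal G {B} {K₂ s k} isB (K₂-nonSeparable s k s≢k) (K₂-≤S s k G sk) B≤K₂)
                       (K₂-vs⁺ s k (inj₂ refl)))

module _ {n : ℕ} where

  Unique-split⇒All≢ : ∀ (as : List (Fin n)) {v bs} → Unique (as ++ v ∷ bs) → All (_≢ v) (bs ++ as)
  Unique-split⇒All≢ as {v} {bs} U = All-++⁺ (after as U) (before as U)
    where
      before : ∀ as → Unique (as ++ v ∷ bs) → All (_≢ v) as
      before [] _ = []
      before (a ∷ as) (a∉ ∷ U) = (λ a≡v → All≢-∈ a∉ (∈-++⁺ʳ as (here refl)) (sym a≡v)) ∷ before as U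
      after : ∀ as → Unique (as ++ v ∷ bs) → All (_≢ v) bs
      after [] (v∉ ∷ _) = All-map (λ v≢z z≡v → v≢z (sym z≡v)) v∉
      after (a ∷ as) (_ ∷ U) = after as U

  ∈-∷ʳ-head : ∀ {v x : Fin n} c → v ∈ˡ c ++ x ∷ [] → x ∈ˡ c → v ∈ˡ c
  ∈-∷ʳ-head c m x∈c with ∈-++⁻ c m
  ... | inj₁ a = a
  ... | inj₂ (here refl) = x∈c

  module Cycle (G : Graph n) (x y z : Fin n) (rest : List (Fin n))
               (U : Unique (x ∷ y ∷ z ∷ rest)) (closed : Linked (Edge (asSub G)) (x ∷ y ∷ z ∷ rest ++ x ∷ [])) where

    private
      c : List (Fin n)
      c = x ∷ y ∷ z ∷ rest

      round : List (Fin n)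
      round = c ++ x ∷ []

      on-cycle? : ∀ k → Dec (k ∈ˡ c)
      on-cycle? k = DecMembership._∈?_ _≟F_ k c

    C : Sub n
    C = toSub on-cycle? (adjacent? round)

    C-vs⁺ : ∀ {k} → k ∈ˡ c → k ∈ˢ vs C
    C-vs⁺ = toSub-vs⁺ on-cycle? (adjacent? round)

    private
      C-vs⁻ = toSub-vs⁻ on-cycle? (adjacent? round)
      C-edge⁺ = toSub-edge⁺ on-cycle? (adjacent? round)
      C-edge⁻ = toSub-edge⁻ on-cycle? (adjacent? round)

      Adjacent⇒Edge : ∀ {a b} → Adjacent round a b → Edge (asSub G) a b
      Adjacent⇒Edge = linked⇒R-Adjacent (λ {a} {b} → adj-sym G a b) closed

      C-wellFormed : WellFormed C
      C-wellFormed = (λ a b e → C-vs⁺ (∈-∷ʳ-head c (Adjacent-∈ˡ (C-edge⁻ e)) (here refl))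
                              , C-vs⁺ (∈-∷ʳ-head c (Adjacent-∈ʳ (C-edge⁻ e)) (here refl))) ,
                     (λ a b e → C-edge⁺ (Adjacent-sym (C-edge⁻ e))) ,
                     (λ a e → irrefl G a (Adjacent⇒Edge (C-edge⁻ e)))

      C-sym : ∀ {a b} → Edge C a b → Edge C b a
      C-sym = edge-sym C C-wellFormed

      linked-round : Linked (Edge C) round
      linked-round = Linked.map C-edge⁺ (linked-Adjacent round)

      C-connected : Connected C
      C-connected = (x , C-vs⁺ (here refl)) , λ u w um wm →
        Star⇒Reach (linked⇒Star-between C-sym linked-round (∈-++⁺ˡ (C-vs⁻ um)) (∈-++⁺ˡ (C-vs⁻ wm)))

      -- Deleting v from the cycle as ++ v ∷ bs leaves the path bs ++ as.
      C-noCutVertex : NoCutVertex C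
      C-noCutVertex v (vm , u , w , um , wm , u≢v , w≢v , _ , ¬r) with ∈-∃++ (C-vs⁻ vm)
      ... | as , bs , c≡ = ¬r (Star⇒Reach (linked⇒Star-between avoid-sym linked-rest (∈-rest (C-vs⁻ um) u≢v) (∈-rest (C-vs⁻ wm) w≢v)))
        where
          round≡ : round ≡ as ++ v ∷ bs ++ x ∷ []
          round≡ = trans (cong (_++ x ∷ []) c≡) (++-assoc as (v ∷ bs) (x ∷ []))
          head≡ : head (as ++ v ∷ []) ≡ just x
          head≡ = head-split as c≡
            where head-split : ∀ {ys} as → x ∷ ys ≡ as ++ v ∷ bs → head (as ++ v ∷ []) ≡ just x
                  head-split [] refl = refl
                  head-split (_ ∷ _) refl = refl
          linked-rest : Linked (EdgeMinus C v) (bs ++ as)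
          linked-rest = linked-All (linked-rotate as bs head≡ (subst (Linked (Edge C)) round≡ linked-round))
                          (Unique-split⇒All≢ as (subst Unique c≡ U))
          avoid-sym : ∀ {a b} → EdgeMinus C v a b → EdgeMinus C v b a
          avoid-sym (e , a≢v , b≢v) = C-sym e , b≢v , a≢v
          ∈-rest : ∀ {k} → k ∈ˡ c → k ≢ v → k ∈ˡ bs ++ as
          ∈-rest m k≢v with ∈-++⁻ as (subst (_ ∈ˡ_) c≡ m)
          ... | inj₁ ma = ∈-++⁺ʳ bs ma
          ... | inj₂ (here k≡v) = ⊥-elim (k≢v k≡v)
          ... | inj₂ (there mb) = ∈-++⁺ˡ mb

    C-nonSeparable : NonSeparable C
    C-nonSeparable = C-wellFormed , C-connected , C-noCutVertex

    C-≤S : C ≤S asSub G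
    C-≤S = (λ _ → ∈⊤) , λ a b e → Adjacent⇒Edge (C-edge⁻ e)

module _ {n : ℕ} (G : Graph n) where

  private
    Gs = asSub G

    G-sym : ∀ {a b} → Edge Gs a b → Edge Gs b a
    G-sym {a} {b} = adj-sym G a b

    avoid-sym : ∀ {v a b} → EdgeMinus Gs v a b → EdgeMinus Gs v b a
    avoid-sym (e , a≢v , b≢v) = G-sym e , b≢v , a≢v

  Star-avoids-or-last-exit : ∀ {v a w} → w ≢ v → Star (Edge Gs) a w →
    (Star (EdgeMinus Gs v) a w × a ≢ v) ⊎ (∃ λ y → Edge Gs v y × y ≢ v × Star (EdgeMinus Gs v) y w)
  Star-avoids-or-last-exit w≢v ε = inj₁ (ε , w≢v)
  Star-avoids-or-last-exit {v} {a} w≢v (e ◅ p) with Star-avoids-or-last-exit w≢v p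
  ... | inj₂ r = inj₂ r
  ... | inj₁ (q , b≢v) with a ≟F v
  ...   | yes refl = inj₂ (_ , e , b≢v , q)
  ...   | no a≢v = inj₁ ((e , a≢v , b≢v) ◅ q , a≢v)

  -- The exits x and y from v towards u and w lie in different blocks: otherwise x and y
  -- would be joined avoiding v, and so would u and w.
  cutVertex⇒two-blocks : ∀ {v} → CutVertex Gs v → ∃₂ λ Bx By → IsBlock G Bx × IsBlock G By × Bx ≢ By
                                                            × ∃ (Edge Bx v) × ∃ (Edge By v)
  cutVertex⇒two-blocks {v} (_ , u , w , _ , _ , u≢v , w≢v , r , ¬r)
    with Star-avoids-or-last-exit w≢v (Reach⇒Star r) | Star-avoids-or-last-exit u≢v (Star-reverse G-sym (Reach⇒Star r))
  ... | inj₁ (q , _) | _ = ⊥-elim (¬r (Star⇒Reach q))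
  ... | _ | inj₁ (q , _) = ⊥-elim (¬r (Star⇒Reach (Star-reverse avoid-sym q)))
  ... | inj₂ (y , vy , y≢v , y⇝w) | inj₂ (x , vx , x≢v , x⇝u) with edge-in-block G vx | edge-in-block G vy
  ...   | Bx , isBx , vx∈Bx | By , isBy , vy∈By = Bx , By , isBx , isBy , Bx≢By , (x , vx∈Bx) , (y , vy∈By)
    where
      Bx≢By : Bx ≢ By
      Bx≢By refl = ¬r (Star⇒Reach (Star-reverse avoid-sym x⇝u ◅◅ x⇝y ◅◅ y⇝w))
        where
          x⇝y : Star (EdgeMinus Gs v) x y
          x⇝y = Star-map (EdgeMinus-mono Bx Gs (proj₁ (proj₂ isBx)))
                  (nonSeparable⇒avoiding-Star Bx (block-nonSeparable G {Bx} isBx)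
                    (proj₂ (edge-endpoints Bx (proj₁ isBx) vx∈Bx)) (proj₂ (edge-endpoints Bx (proj₁ isBx) vy∈By)) x≢v y≢v)

  -- If p ≠ q, a p–q path avoiding e closes a cycle through e, which lies in B; so B and B'
  -- share e and q.
  nonCutVertex-in-one-block : ∀ {e p q B B'} → ¬ CutVertex Gs e → IsBlock G B → IsBlock G B'
                            → Edge B e p → Edge B' e q → B ≡ B'
  nonCutVertex-in-one-block {e} {p} {q} {B} {B'} ¬cut isB isB' ep eq = by-cases (p ≟F q)
    where
      epG = proj₂ (proj₁ (proj₂ isB)) e p ep
      eqG = proj₂ (proj₁ (proj₂ isB')) e q eq
      e≢p = edge-irrefl B (proj₁ isB) ep
      e≢q = edge-irrefl B' (proj₁ isB') eq
      eB = proj₁ (edge-endpoints B (proj₁ isB) ep)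
      pB = proj₂ (edge-endpoints B (proj₁ isB) ep)
      eB' = proj₁ (edge-endpoints B' (proj₁ isB') eq)
      qB' = proj₂ (edge-endpoints B' (proj₁ isB') eq)

      e∉ : ∀ {a b xs} → Linked (EdgeMinus Gs e) (a ∷ b ∷ xs) → All (e ≢_) (a ∷ b ∷ xs)
      e∉ ((_ , a≢e , b≢e) ∷ [-]) = (λ e≡a → a≢e (sym e≡a)) ∷ (λ e≡b → b≢e (sym e≡b)) ∷ []
      e∉ ((_ , a≢e , _) ∷ (r ∷ l)) = (λ e≡a → a≢e (sym e≡a)) ∷ e∉ (r ∷ l)

      close-cycle : p ≢ q → ∀ ps → SimplePath {R = EdgeMinus Gs e} p q ps → B ≡ B'
      close-cycle p≢q (x ∷ []) (_ , _ , refl , refl) = ⊥-elim (p≢q refl)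
      close-cycle _ (x ∷ z ∷ rest) (U , lk , refl , l) = blocks-sharing-two-vertices-equal G {B} {B'} isB isB' e≢q eB qB eB' qB'
        where
          open Cycle G e x z rest (e∉ lk ∷ U) (epG ∷ linked-∷ʳ (x ∷ z ∷ rest) (Linked.map proj₁ lk) l (G-sym eqG))
          C≤B : C ≤S B
          C≤B = nonSeparable-≤S-block G {C} {B} C-nonSeparable C-≤S isB e≢p (C-vs⁺ (here refl)) (C-vs⁺ (there (here refl))) eB pB
          qB = proj₁ C≤B (C-vs⁺ (there (last-∈ {ps = x ∷ z ∷ rest} l)))

      through-cycle : p ≢ q → Dec (Star (EdgeMinus Gs e) p q) → B ≡ B'
      through-cycle p≢q (yes p⇝q) = let (ps , path) = Star⇒SimplePath p⇝q in close-cycle p≢q ps path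
      through-cycle _ (no ¬p⇝q) = ⊥-elim (¬cut (∈⊤ , p , q , ∈⊤ , ∈⊤ , (λ p≡e → e≢p (sym p≡e)) , (λ q≡e → e≢q (sym q≡e)) ,
        Star⇒Reach (G-sym epG ◅ eqG ◅ ε) , λ r → ¬p⇝q (Reach⇒Star r)))

      by-cases : Dec (p ≡ q) → B ≡ B'
      by-cases (yes refl) = blocks-sharing-two-vertices-equal G {B} {B'} isB isB' e≢p eB pB eB' qB'
      by-cases (no p≢q) = through-cycle p≢q (star? (edgeMinus? Gs e) p q)

  connected⇒has-edge : Connected Gs → ∀ {i j} → j ≢ i → ∃ (Edge Gs i)
  connected⇒has-edge (_ , c) {i} {j} j≢i = first-step (Reach⇒Star (c i j ∈⊤ ∈⊤))
    where
      first-step : Star (Edge Gs) i j → ∃ (Edge Gs i)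
      first-step ε = ⊥-elim (j≢i refl)
      first-step (e ◅ _) = _ , e

private
  connected-Sub₁-unique : ∀ (B : Sub 1) → WellFormed B → Connected B → B ≡ sub (inside ∷ []) ((outside ∷ []) ∷ [])
  connected-Sub₁-unique (sub (inside ∷ []) ((outside ∷ []) ∷ [])) _ _ = refl
  connected-Sub₁-unique (sub (outside ∷ []) _) _ ((zero , ()) , _)
  connected-Sub₁-unique (sub (_ ∷ []) ((inside ∷ []) ∷ [])) (_ , _ , irr) _ = ⊥-elim (irr zero _[_]=_.here)

two-blocks⇒another-vertex : ∀ {n} (G : Graph n) → (∃₂ λ B₁ B₂ → IsBlock G B₁ × IsBlock G B₂ × B₁ ≢ B₂)
                          → (i : Fin n) → ∃ λ j → j ≢ i
two-blocks⇒another-vertex {suc zero} G (B₁ , B₂ , (w₁ , _ , c₁ , _) , (w₂ , _ , c₂ , _) , B₁≢B₂) i =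
  ⊥-elim (B₁≢B₂ (trans (connected-Sub₁-unique B₁ w₁ c₁) (sym (connected-Sub₁-unique B₂ w₂ c₂))))
two-blocks⇒another-vertex {suc (suc m)} G _ zero = suc zero , λ ()
two-blocks⇒another-vertex {suc (suc m)} G _ (suc i) = zero , λ ()

-- Degrees and internal vertices

module _ {n : ℕ} (T : Sub n) where

  two-neighbours⇒internal : ∀ {i a b} → a ≢ b → Edge T i a → Edge T i b → 2 ≤ degree T i
  two-neighbours⇒internal {i} {a} {b} a≢b ia ib =
    subst (_< degree T i) (∣⁅x⁆∣≡1 a) (p⊂q⇒∣p∣<∣q∣ (⁅a⁆⊆ , b , ib , x≢y⇒x∉⁅y⁆ (λ b≡a → a≢b (sym b≡a))))
    where
      ⁅a⁆⊆ : ⁅ a ⁆ ⊆ lookup (es T) i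
      ⁅a⁆⊆ m = subst (_∈ˢ lookup (es T) i) (sym (x∈⁅y⁆⇒x≡y a m)) ia

  one-neighbour⇒leaf : ∀ {i a} → (∀ q → Edge T i q → q ≡ a) → ¬ (2 ≤ degree T i)
  one-neighbour⇒leaf {i} {a} only-a 2≤deg = ≤⇒≯ (≤-trans 2≤deg deg≤1) (s≤s (s≤s z≤n))
    where
      deg≤1 : degree T i ≤ 1
      deg≤1 = subst (degree T i ≤_) (∣⁅x⁆∣≡1 a) (p⊆q⇒∣p∣≤∣q∣ (λ {x} m → subst (_∈ˢ ⁅ a ⁆) (sym (only-a x m)) (x∈⁅x⁆ a)))

  private
    Leaf? : ∀ i → Dec (¬ 2 ≤ degree T i)
    Leaf? i = ¬? (2 ≤? degree T i)


  internalCount-by-leaves : ∀ {A : Set} (L : List A) (leaf : A → Fin n) → Unique L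
    → (∀ {a b} → a ∈ˡ L → b ∈ˡ L → leaf a ≡ leaf b → a ≡ b)
    → (∀ {a} → a ∈ˡ L → ¬ 2 ≤ degree T (leaf a))
    → (∀ i → ¬ 2 ≤ degree T i → ∃ λ a → a ∈ˡ L × leaf a ≡ i)
    → internalCount T ≡ n ∸ length L
  internalCount-by-leaves L leaf U-L leaf-injective leaf-is-leaf leaf-onto = begin
    internalCount T                                   ≡⟨ m+n∸n≡m (internalCount T) (length leaves) ⟨
    internalCount T + length leaves ∸ length leaves   ≡⟨ cong (_∸ length leaves) (length-filter-+-filter-¬ (λ i → 2 ≤? degree T i) (allFin n)) ⟩
    length (allFin n) ∸ length leaves                 ≡⟨ cong₂ _∸_ (length-tabulate (λ i → i)) #leaves ⟩
    n ∸ length L                                      ∎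
    where
      open ≡-Reasoning
      leaves : List (Fin n)
      leaves = filter Leaf? (allFin n)
      labels : List (Fin n)
      labels = map leaf L
      U-labels : Unique labels
      U-labels = Unique-map⁺-on leaf U-L leaf-injective
      #leaves : length leaves ≡ length L
      #leaves = trans (≤-antisym
          (unique-⊆⇒length≤ _≟F_ leaves labels (filter⁺ Leaf? (allFin⁺ n))
            (λ m → let (a , a∈L , leaf≡) = leaf-onto _ (proj₂ (∈-filter⁻ Leaf? {xs = allFin n} m)) in subst (_∈ˡ labels) leaf≡ (∈-map⁺ leaf a∈L)))
          (unique-⊆⇒length≤ _≟F_ labels leaves U-labels
            (λ m → let (a , a∈L , leaf≡) = ∈-map⁻ leaf m in ∈-filter⁺ Leaf? (∈-allFin _) (subst (λ j → ¬ 2 ≤ degree T j) (sym leaf≡) (leaf-is-leaf a∈L)))))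
        (length-map leaf L)

-- The union of the chosen spanning paths of the blocks

module SpanningTree {n : ℕ} (G : Graph n) (G-connected : Connected (asSub G))
  (has-edge : ∀ i → ∃ (Edge (asSub G) i))
  (spanning-paths : ∀ B → IsBlock G B → ∃₂ λ u v → SpanningPath B u v × (CutVertex (asSub G) u ⊎ CutVertex (asSub G) v))
  where

  private
    Gs = asSub G
    Cut = CutVertex Gs

  data PathKind (B : Sub n) (s t : Fin n) : Set where
    between-cuts : s ≢ t → Cut s → Cut t → PathKind B s t
    from-cut : ¬ Good G B → Cut s → PathKind B s t
    to-cut : ¬ Good G B → Cut t → PathKind B s t

  -- The end not known to be a cut vertex; meaningful for bad blocks only.
  leafEnd : ∀ {B s t} → PathKind B s t → Fin n
  leafEnd {s = s} (between-cuts _ _ _) = s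
  leafEnd {t = t} (from-cut _ _) = t
  leafEnd {s = s} (to-cut _ _) = s

  record ChosenPath (B : Sub n) : Set where
    field
      start end : Fin n
      spanning : SpanningPath B start end
      kind : PathKind B start end

    path : List (Fin n)
    path = proj₁ spanning

    path-unique : Unique path
    path-unique = proj₁ (proj₂ spanning)

    path-linked : Linked (Edge B) path
    path-linked = proj₁ (proj₂ (proj₂ spanning))

    path-head : head path ≡ just start
    path-head = proj₁ (proj₂ (proj₂ (proj₂ spanning)))

    path-last : last path ≡ just end
    path-last = proj₁ (proj₂ (proj₂ (proj₂ (proj₂ spanning))))

    path-⊆ : All (_∈ˢ vs B) path
    path-⊆ = proj₁ (proj₂ (proj₂ (proj₂ (proj₂ (proj₂ spanning)))))

    path-⊇ : ∀ x → x ∈ˢ vs B → x ∈ˡ path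
    path-⊇ = proj₂ (proj₂ (proj₂ (proj₂ (proj₂ (proj₂ spanning)))))

  choose : ∀ B → IsBlock G B → ChosenPath B
  choose B isB with good? G B
  ... | yes (u , v , u≢v , cu , cv , sp) = record { start = u ; end = v ; spanning = sp ; kind = between-cuts u≢v cu cv }
  ... | no ¬good with spanning-paths B isB
  ...   | u , v , sp , inj₁ cu = record { start = u ; end = v ; spanning = sp ; kind = from-cut ¬good cu }
  ...   | u , v , sp , inj₂ cv = record { start = u ; end = v ; spanning = sp ; kind = to-cut ¬good cv }

  -- The choice must depend on B alone (not on a proof that B is a block) for the tree edges
  -- to be decidable; opacity keeps the exhaustive searches from being unfolded.
  opaque
    chosen : ∀ B → Maybe (ChosenPath B)
    chosen B with isBlock? G B
    ... | yes isB = just (choose B isB)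
    ... | no _ = nothing

    chosen-block : ∀ {B} → IsBlock G B → Σ (ChosenPath B) λ ch → chosen B ≡ just ch
    chosen-block {B} isB with isBlock? G B
    ... | yes isB' = choose B isB' , refl
    ... | no ¬isB = ⊥-elim (¬isB isB)

  pathOf : Sub n → List (Fin n)
  pathOf B = maybe ChosenPath.path [] (chosen B)

  -- Non-blocks get an arbitrary vertex.
  leafOf : Sub n → Fin n
  leafOf B = maybe (λ ch → leafEnd (ChosenPath.kind ch)) (proj₁ (proj₁ G-connected)) (chosen B)

  TreeEdge : Rel n
  TreeEdge i j = ∃ λ B → IsBlock G B × Adjacent (pathOf B) i j

  opaque
    treeEdge? : Decidable TreeEdge
    treeEdge? i j = any-sub? (λ B → isBlock? G B ×-dec adjacent? (pathOf B) i j)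

  T : Sub n
  T = sub ⊤ (tabulate (λ k → toSubset (treeEdge? k)))

  T-edge⁺ : ∀ {a b} → TreeEdge a b → Edge T a b
  T-edge⁺ = toSub-edge⁺ (λ _ → yes tt) treeEdge?

  T-edge⁻ : ∀ {a b} → Edge T a b → TreeEdge a b
  T-edge⁻ = toSub-edge⁻ (λ _ → yes tt) treeEdge?

  module Block {B : Sub n} (isB : IsBlock G B) where

    chosen-path : ChosenPath B
    chosen-path = proj₁ (chosen-block isB)

    open ChosenPath chosen-path public

    pathOf≡ : pathOf B ≡ path
    pathOf≡ = cong (maybe ChosenPath.path []) (proj₂ (chosen-block isB))

    pathOf-unique : Unique (pathOf B)
    pathOf-unique = subst Unique (sym pathOf≡) path-unique

    pathOf-head : head (pathOf B) ≡ just start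
    pathOf-head = trans (cong head pathOf≡) path-head

    pathOf-last : last (pathOf B) ≡ just end
    pathOf-last = trans (cong last pathOf≡) path-last

    ∈-pathOf⁺ : ∀ {a} → a ∈ˢ vs B → a ∈ˡ pathOf B
    ∈-pathOf⁺ {a} m = subst (a ∈ˡ_) (sym pathOf≡) (path-⊇ a m)

    ∈-pathOf⁻ : ∀ {a} → a ∈ˡ pathOf B → a ∈ˢ vs B
    ∈-pathOf⁻ {a} m = All-∈ path-⊆ (subst (a ∈ˡ_) pathOf≡ m)
      where All-∈ : ∀ {P : Fin n → Set} {xs} → All P xs → a ∈ˡ xs → P a
            All-∈ (p ∷ _) (here refl) = p
            All-∈ (_ ∷ ps) (there m) = All-∈ ps m

    Adjacent⇒Edge : ∀ {a b} → Adjacent (pathOf B) a b → Edge B a b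
    Adjacent⇒Edge adj = linked⇒R-Adjacent (edge-sym B (proj₁ isB)) path-linked (subst (λ p → Adjacent p _ _) pathOf≡ adj)

    Adjacent⇒≢ : ∀ {a b} → Adjacent (pathOf B) a b → a ≢ b
    Adjacent⇒≢ adj = edge-irrefl B (proj₁ isB) (Adjacent⇒Edge adj)

    Adjacent⇒T : ∀ {a b} → Adjacent (pathOf B) a b → Edge T a b
    Adjacent⇒T adj = T-edge⁺ (B , isB , adj)

    Edge⇒Star-T : ∀ {a b} → Edge B a b → Star (Edge T) a b
    Edge⇒Star-T e = Star-map Adjacent⇒T (linked⇒Star-between Adjacent-sym (linked-Adjacent (pathOf B))
      (∈-pathOf⁺ (proj₁ (edge-endpoints B (proj₁ isB) e))) (∈-pathOf⁺ (proj₂ (edge-endpoints B (proj₁ isB) e))))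

    edge⇒path-neighbour : ∀ {v x} → Edge B v x → ∃ (Adjacent (pathOf B) v)
    edge⇒path-neighbour vx = has-Adjacent (∈-pathOf⁺ (proj₁ (edge-endpoints B (proj₁ isB) vx)))
      (∈-pathOf⁺ (proj₂ (edge-endpoints B (proj₁ isB) vx))) (λ x≡v → edge-irrefl B (proj₁ isB) vx (sym x≡v))

    leafOf≡ : leafOf B ≡ leafEnd kind
    leafOf≡ = cong (maybe (λ ch → leafEnd (ChosenPath.kind ch)) (proj₁ (proj₁ G-connected))) (proj₂ (chosen-block isB))

    start≢end : start ≢ end
    start≢end start≡end = block-not-singleton G {B} isB (proj₂ (has-edge start)) only-start
      where
        path≡ : path ≡ start ∷ []
        path≡ = unique-head≡last⇒singleton path-unique path-head (subst (λ t → last path ≡ just t) (sym start≡end) path-last)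
        only-start : ∀ {x} → x ∈ˢ vs B → x ≡ start
        only-start {x} m with subst (x ∈ˡ_) path≡ (path-⊇ x m)
        ... | here x≡start = x≡start

    head≡start : ∀ {i} → head (pathOf B) ≡ just i → i ≡ start
    head≡start h = just-injective (trans (sym h) pathOf-head)

    last≡end : ∀ {i} → last (pathOf B) ≡ just i → i ≡ end
    last≡end l = just-injective (trans (sym l) pathOf-last)

    nonCut-end⇒bad-leaf : ∀ {i} → IsEnd (pathOf B) i → ¬ Cut i → Bad G B × leafOf B ≡ i
    nonCut-end⇒bad-leaf {i} i-end ¬cut with kind in kind≡ | i-end
    ... | between-cuts _ cut _ | inj₁ h = ⊥-elim (¬cut (subst Cut (sym (head≡start h)) cut))
    ... | between-cuts _ _ cut | inj₂ l = ⊥-elim (¬cut (subst Cut (sym (last≡end l)) cut))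
    ... | from-cut _ cut | inj₁ h = ⊥-elim (¬cut (subst Cut (sym (head≡start h)) cut))
    ... | from-cut ¬good _ | inj₂ l = (isB , ¬good) , trans leafOf≡ (trans (cong leafEnd kind≡) (sym (last≡end l)))
    ... | to-cut ¬good _ | inj₁ h = (isB , ¬good) , trans leafOf≡ (trans (cong leafEnd kind≡) (sym (head≡start h)))
    ... | to-cut _ cut | inj₂ l = ⊥-elim (¬cut (subst Cut (sym (last≡end l)) cut))

    bad⇒leaf-nonCut-end : ¬ Good G B → ¬ Cut (leafOf B) × IsEnd (pathOf B) (leafOf B)
    bad⇒leaf-nonCut-end ¬good with kind in kind≡
    ... | between-cuts s≢t cs ct = ⊥-elim (¬good (start , end , s≢t , cs , ct , spanning))
    ... | from-cut _ cs = subst (λ l → ¬ Cut l × IsEnd (pathOf B) l) (sym (trans leafOf≡ (cong leafEnd kind≡)))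
            ((λ ct → ¬good (start , end , start≢end , cs , ct , spanning)) , inj₂ pathOf-last)
    ... | to-cut _ ct = subst (λ l → ¬ Cut l × IsEnd (pathOf B) l) (sym (trans leafOf≡ (cong leafEnd kind≡)))
            ((λ cs → ¬good (start , end , start≢end , cs , ct , spanning)) , inj₁ pathOf-head)

    bad⇒leaf-has-Adjacent : ¬ Good G B → ∃ (Adjacent (pathOf B) (leafOf B))
    bad⇒leaf-has-Adjacent ¬good with proj₂ (bad⇒leaf-nonCut-end ¬good)
    ... | inj₁ h = has-Adjacent (head-∈ h) (last-∈ pathOf-last) (λ end≡ → start≢end (trans (sym (head≡start h)) (sym end≡)))
    ... | inj₂ l = has-Adjacent (last-∈ l) (head-∈ pathOf-head) (λ start≡ → start≢end (trans start≡ (last≡end l)))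

  open Block using (Adjacent⇒Edge; Adjacent⇒≢; Adjacent⇒T; ∈-pathOf⁺; ∈-pathOf⁻; pathOf-unique)

  TreeEdge⇒Edge : ∀ {a b} → TreeEdge a b → Edge Gs a b
  TreeEdge⇒Edge (B , isB , adj) = proj₂ (proj₁ (proj₂ isB)) _ _ (Adjacent⇒Edge {B} isB adj)

  T-wellFormed : WellFormed T
  T-wellFormed = (λ _ _ _ → ∈⊤ , ∈⊤)
               , (λ i j e → let (B , isB , adj) = T-edge⁻ e in T-edge⁺ (B , isB , Adjacent-sym adj))
               , (λ i e → irrefl G i (TreeEdge⇒Edge (T-edge⁻ e)))

  T-≤S : T ≤S Gs
  T-≤S = (λ _ → ∈⊤) , λ i j e → TreeEdge⇒Edge (T-edge⁻ e)

  T-connected : Connected T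
  T-connected = (proj₁ (proj₁ G-connected) , ∈⊤) , λ u w _ _ →
    Star⇒Reach ((Edge⇒Star-T ⋆) (Reach⇒Star (proj₂ G-connected u w ∈⊤ ∈⊤)))
    where
      Edge⇒Star-T : ∀ {a b} → Edge Gs a b → Star (Edge T) a b
      Edge⇒Star-T e = let (B , isB , e-B) = edge-in-block G e in Block.Edge⇒Star-T {B} isB e-B

  -- A cycle of T is nonseparable, hence inside the block B of its first edge; each of its
  -- edges joins two vertices of B and so comes from the path of B, which is acyclic.
  T-acyclic : Acyclic T
  T-acyclic x y z rest U@((x≢y ∷ _) ∷ _) cycle =
    path-acyclic (pathOf-unique {B} isB) x y z rest U (Linked.map in-path (linked-All cycle on-cycle))
    where
      open Cycle G x y z rest U (Linked.map (λ e → TreeEdge⇒Edge (T-edge⁻ e)) cycle)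
      first = T-edge⁻ (Linked.head cycle)
      B = proj₁ first
      isB = proj₁ (proj₂ first)
      xy = proj₂ (proj₂ first)
      C≤B : C ≤S B
      C≤B = nonSeparable-≤S-block G {C} {B} C-nonSeparable C-≤S isB x≢y (C-vs⁺ (here refl)) (C-vs⁺ (there (here refl)))
              (∈-pathOf⁻ {B} isB (Adjacent-∈ˡ xy)) (∈-pathOf⁻ {B} isB (Adjacent-∈ʳ xy))
      on-cycle : All (_∈ˡ x ∷ y ∷ z ∷ rest) (x ∷ y ∷ z ∷ rest ++ x ∷ [])
      on-cycle = All-tabulate (λ m → ∈-∷ʳ-head (x ∷ y ∷ z ∷ rest) m (here refl))
      in-path : ∀ {p q} → Edge T p q × p ∈ˡ x ∷ y ∷ z ∷ rest × q ∈ˡ x ∷ y ∷ z ∷ rest → Adjacent (pathOf B) p q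
      in-path (e , p∈ , q∈) with T-edge⁻ e
      ... | B' , isB' , adj = subst (λ B → Adjacent (pathOf B) _ _)
              (blocks-sharing-two-vertices-equal G {B'} {B} isB' isB (Adjacent⇒≢ {B'} isB' adj)
                (∈-pathOf⁻ {B'} isB' (Adjacent-∈ˡ adj)) (∈-pathOf⁻ {B'} isB' (Adjacent-∈ʳ adj))
                (proj₁ C≤B (C-vs⁺ p∈)) (proj₁ C≤B (C-vs⁺ q∈)))
              adj

  -- Each of the two blocks at a cut vertex contributes a path neighbour, and these differ
  -- since two blocks share at most one vertex.
  cutVertex⇒internal : ∀ {v} → Cut v → 2 ≤ degree T v
  cutVertex⇒internal cut with cutVertex⇒two-blocks G cut
  ... | Bx , By , isBx , isBy , Bx≢By , (_ , vx) , (_ , vy) =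
    two-neighbours⇒internal T a≢b (Adjacent⇒T {Bx} isBx (proj₂ a)) (Adjacent⇒T {By} isBy (proj₂ b))
    where
      a = Block.edge⇒path-neighbour {Bx} isBx vx
      b = Block.edge⇒path-neighbour {By} isBy vy
      a≢b : proj₁ a ≢ proj₁ b
      a≢b a≡b = Bx≢By (blocks-sharing-two-vertices-equal G {Bx} {By} isBx isBy (Adjacent⇒≢ {Bx} isBx (proj₂ a))
        (∈-pathOf⁻ {Bx} isBx (Adjacent-∈ˡ (proj₂ a))) (∈-pathOf⁻ {Bx} isBx (Adjacent-∈ʳ (proj₂ a)))
        (∈-pathOf⁻ {By} isBy (Adjacent-∈ˡ (proj₂ b))) (subst (_∈ˢ vs By) (sym a≡b) (∈-pathOf⁻ {By} isBy (Adjacent-∈ʳ (proj₂ b)))))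

  internal-or-leaf : ∀ i → 2 ≤ degree T i ⊎ ∃ λ B → Bad G B × leafOf B ≡ i
  internal-or-leaf i with edge-in-block G (proj₂ (has-edge i))
  ... | B , isB , ik with interior-or-end (∈-pathOf⁺ {B} isB (proj₁ (edge-endpoints B (proj₁ isB) ik)))
  ...   | inj₁ (a , b , ai , ib) = inj₁ (two-neighbours⇒internal T (interior-neighbours-distinct (pathOf-unique {B} isB) ai ib)
                                   (Adjacent⇒T {B} isB (inj₂ ai)) (Adjacent⇒T {B} isB (inj₁ ib)))
  ...   | inj₂ i-end with cutVertex? Gs i
  ...     | yes cut = inj₁ (cutVertex⇒internal cut)
  ...     | no ¬cut = inj₂ (B , Block.nonCut-end⇒bad-leaf {B} isB i-end ¬cut)

  leaf-in-one-block : ∀ {B B' q} → Bad G B → IsBlock G B' → Adjacent (pathOf B') (leafOf B) q → B ≡ B'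
  leaf-in-one-block {B} {B'} (isB , ¬good) isB' adj =
    nonCutVertex-in-one-block G {B = B} {B'} (proj₁ (Block.bad⇒leaf-nonCut-end {B} isB ¬good)) isB isB'
      (Adjacent⇒Edge {B} isB (proj₂ (Block.bad⇒leaf-has-Adjacent {B} isB ¬good))) (Adjacent⇒Edge {B'} isB' adj)

  leaf-not-internal : ∀ {B} → Bad G B → ¬ 2 ≤ degree T (leafOf B)
  leaf-not-internal {B} bad@(isB , ¬good) = one-neighbour⇒leaf T only-neighbour
    where
      neighbour = Block.bad⇒leaf-has-Adjacent {B} isB ¬good
      only-neighbour : ∀ q → Edge T (leafOf B) q → q ≡ proj₁ neighbour
      only-neighbour q e with T-edge⁻ e
      ... | B' , isB' , adj with leaf-in-one-block bad isB' adj
      ...   | refl = end-Adjacent-unique (pathOf-unique {B} isB) (proj₂ (Block.bad⇒leaf-nonCut-end {B} isB ¬good)) adj (proj₂ neighbour)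

  leaf-injective : ∀ {B B'} → Bad G B → Bad G B' → leafOf B ≡ leafOf B' → B ≡ B'
  leaf-injective {B} {B'} bad (isB' , ¬good') leaf≡ =
    leaf-in-one-block bad isB' (subst (λ l → Adjacent (pathOf B') l (proj₁ neighbour)) (sym leaf≡) (proj₂ neighbour))
    where neighbour = Block.bad⇒leaf-has-Adjacent {B'} isB' ¬good'

  internalCount-T : ∀ L → EnumeratesBad G L → internalCount T ≡ n ∸ length L
  internalCount-T L (U , L⊆Bad , Bad⊆L) = internalCount-by-leaves T L leafOf U
    (λ a∈L b∈L → leaf-injective (L⊆Bad _ a∈L) (L⊆Bad _ b∈L))
    (λ a∈L → leaf-not-internal (L⊆Bad _ a∈L))
    leaf-onto
    where
      leaf-onto : ∀ i → ¬ 2 ≤ degree T i → ∃ λ B → B ∈ˡ L × leafOf B ≡ i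
      leaf-onto i ¬internal with internal-or-leaf i
      ... | inj₁ internal = ⊥-elim (¬internal internal)
      ... | inj₂ (B , bad , leaf≡) = B , Bad⊆L B bad , leaf≡

theorem2 : ∀ (n : ℕ) (G : Graph n) →
    Connected (asSub G) →
    (∃ λ B₁ → ∃ λ B₂ → IsBlock G B₁ × IsBlock G B₂ × B₁ ≢ B₂) →
    (∀ B → IsBlock G B → ∃ λ u → ∃ λ v → SpanningPath B u v
                                    × (CutVertex (asSub G) u ⊎ CutVertex (asSub G) v)) →
    ∀ (L : List (Sub n)) → EnumeratesBad G L →
    ∃ λ T → IsSpanningTree G T × internalCount T ≡ n ∸ length L
theorem2 n G connected two-blocks spanning-paths L enumerates =
  T , (refl , T-wellFormed , T-≤S , T-connected , T-acyclic) , internalCount-T L enumerates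
  where
    has-edge : ∀ i → ∃ (Edge (asSub G) i)
    has-edge i = connected⇒has-edge G connected (proj₂ (two-blocks⇒another-vertex G two-blocks i))

    open SpanningTree G connected has-edge spanning-paths
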